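{- If $\pi$ is a partition with exactly one block, then $$S_\pi(q,p,z)=\cfrac{1}{1-([1]_{q,p}+1)z-\cfrac{[1]_{q,p}z^2}{1-([2]_{q,p}+1)z-\cfrac{[2]_{q,p}z^2}{\ddots}}}.$$
   Context: Partitions are drawn with arcs joining consecutive elements of each block; $cr(\mu)$, $ne(\mu)$ count pairs of arcs $(i_1,j_1),(i_2,j_2)$ with $i_1<i_2<j_1<j_2$, resp. $i_1<i_2<j_2<j_1$. The tree of partitions has root the empty partition, and a partition of $[N+1]$ is a child of a partition $\nu$ of $[N]$ iff its restriction to $\{2,\dots,N+1\}$ is order-isomorphic to $\nu$; for $\pi$ a partition of $[n]$, $\mathcal{T}(\pi,l)$ is the set of partitions of $[n+l]$ whose restriction to the last $n$ elements is order-isomorphic to $\pi$. $S_\pi(q,p,z)=\sum_{l\ge0}\sum_{\lambda\in\mathcal{T}(\pi,l)}q^{cr(\lambda)}p^{ne(\lambda)}z^l$, and $[r]_{q,p}=\frac{q^r-p^r}{q-p}$. -}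

module Defs where

open import Data.Nat using (ℕ; zero; suc; _+_; _*_; _∸_; _^_; _≡ᵇ_; _<ᵇ_)
open import Data.Bool using (Bool; true; false; _∧_; not; if_then_else_)
open import Data.List using (List; []; _∷_; _++_; map; concatMap; upTo; length; drop)
open import Data.Nat.ListAction using (sum)
open import Data.Bool.ListAction using (and)

all : {A : Set} → (A → Bool) → List A → Bool
all f xs = and (map f xs)
open import Data.Product using (_×_; _,_)

-- Set partitions of [m] are encoded canonically by restricted growth
-- sequences (a_1,...,a_m): a_1 = 0 and a_{i+1} ≤ 1 + max(a_1..a_i);
-- i and j lie in the same block iff a_i = a_j.  Positions are 0-based.

-- Safe indexing (default 0, only used in range).
at : List ℕ → ℕ → ℕ
at []       _       = 0
at (x ∷ xs) zero    = x
at (x ∷ xs) (suc i) = at xs i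

-- All restricted growth sequences of length m, paired with the number of
-- blocks used so far.
rgsAux : ℕ → List (List ℕ × ℕ)
rgsAux zero    = ([] , 0) ∷ []
rgsAux (suc m) = concatMap ext (rgsAux m)
  where
  ext : List ℕ × ℕ → List (List ℕ × ℕ)
  ext (s , k) = map (λ c → (s ++ (c ∷ []) , (if c ≡ᵇ k then suc k else k))) (upTo (suc k))

partitions : ℕ → List (List ℕ)
partitions m = map (λ { (s , _) → s }) (rgsAux m)

isArc : List ℕ → ℕ → ℕ → Bool
isArc a i j = (i <ᵇ j) ∧ (at a i ≡ᵇ at a j)
            ∧ all (λ t → not (at a (suc i + t) ≡ᵇ at a i)) (upTo (j ∸ suc i))

arcs : List ℕ → List (ℕ × ℕ)
arcs a = concatMap (λ i → concatMap (λ j → if isArc a i j then (i , j) ∷ [] else [])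
                                   (upTo (length a)))
                   (upTo (length a))

countPairs : (ℕ × ℕ → ℕ × ℕ → Bool) → List (ℕ × ℕ) → ℕ
countPairs R as = sum (concatMap (λ x → map (λ y → if R x y then 1 else 0) as) as)

crossingRel : ℕ × ℕ → ℕ × ℕ → Bool
crossingRel (i₁ , j₁) (i₂ , j₂) = (i₁ <ᵇ i₂) ∧ (i₂ <ᵇ j₁) ∧ (j₁ <ᵇ j₂)

nestingRel : ℕ × ℕ → ℕ × ℕ → Bool
nestingRel (i₁ , j₁) (i₂ , j₂) = (i₁ <ᵇ i₂) ∧ (i₂ <ᵇ j₂) ∧ (j₂ <ᵇ j₁)

cr : List ℕ → ℕ
cr a = countPairs crossingRel (arcs a)

ne : List ℕ → ℕ
ne a = countPairs nestingRel (arcs a)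

_==_ : Bool → Bool → Bool
true  == b = b
false == b = not b

-- a (a partition of [n + l]) lies in T(π , l), π a partition of [n]:
-- the restriction of a to its last n elements is order-isomorphic to π,
-- i.e. for all i , j < n: a_{l+i}, a_{l+j} in same block iff π_i, π_j are.
inT : (n : ℕ) → List ℕ → ℕ → List ℕ → Bool
inT n π l a = all (λ i → all (λ j → (at b i ≡ᵇ at b j) == (at π i ≡ᵇ at π j)) (upTo n)) (upTo n)
  where b = drop l a

-- Coefficient of z^l in S_π(q,p,z), π a partition of [n].
Scoeff : ℕ → ℕ → (n : ℕ) → List ℕ → ℕ → ℕ
Scoeff q p n π l =
  sum (map (λ a → if inT n π l a then q ^ cr a * p ^ ne a else 0) (partitions (n + l)))

-- [r]_{q,p} = (q^r - p^r)/(q - p) = Σ_{i<r} q^i p^{r-1-i}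
qpInt : ℕ → ℕ → ℕ → ℕ
qpInt q p r = sum (map (λ i → q ^ i * p ^ (r ∸ suc i)) (upTo r))

-- Formal power series in z, as coefficient functions.
Series : Set
Series = ℕ → ℕ

mulS : Series → Series → Series
mulS f g n = sum (map (λ i → f i * g (n ∸ i)) (upTo (suc n)))

powS : Series → ℕ → Series
powS X zero    = λ n → if n ≡ᵇ 0 then 1 else 0
powS X (suc k) = mulS X (powS X k)

-- 1/(1 - X) for X with zero constant term: Σ_k X^k
geomS : Series → Series
geomS X n = sum (map (λ k → powS X k n) (upTo (suc n)))

shift2 : Series → Series
shift2 F zero          = 0
shift2 F (suc zero)    = 0
shift2 F (suc (suc m)) = F m

-- Level-h tail of the J-fraction, truncated after r further levels (the
-- innermost tail replaced by 0):
--   F_h = 1 / (1 - ([h+1]+1) z - [h+1] z^2 F_{h+1}).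
cfTail : ℕ → ℕ → ℕ → ℕ → Series
cfTail q p zero    h = λ _ → 0
cfTail q p (suc r) h = geomS (λ n → (qpInt q p (suc h) + 1) * (if n ≡ᵇ 1 then 1 else 0)
                                    + qpInt q p (suc h) * shift2 (cfTail q p r (suc h)) n)

convergent : ℕ → ℕ → ℕ → Series
convergent q p D = cfTail q p D 0

-- For π a single block, λ ∈ T(π, l) means that the last elements of λ all lie in
-- one block; deleting all but the first of them changes neither crossings nor
-- nestings, so the coefficient of z^l in S_π is the crossing/nesting polynomial
-- of the partitions of [l + 1].  Building a partition element by element and
-- recording, for every block, the arcs passing over its last element and the arcs
-- starting after it, that polynomial becomes a sum over Motzkin paths with level
-- weight 1 + [h] and fall weight [h] at height h.  Splitting off the first step
-- turns these into paths with level weight [h + 1] + 1 and fall weight [h + 1],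
-- and the first-passage decomposition of such paths is the J-fraction.

module Submission where

open import Defs
open import Data.Nat using (ℕ; suc; _≤_; _<_; s≤s; z≤n)
open import Data.List using (replicate)
open import Relation.Binary.PropositionalEquality using (_≡_)

module FiniteSums where

  open import Data.Nat
  open import Data.Nat.Properties
  open import Data.Nat.Tactic.RingSolver using (solve-∀)
  open import Data.List using (List; []; _∷_; _++_; map; concatMap; upTo; _∷ʳ_)
  open import Data.List.Properties using (upTo-∷ʳ; map-++; map-concatMap)
  open import Data.List.Relation.Unary.All using (All; []; _∷_)
  open import Data.List.Relation.Binary.Permutation.Propositional using (_↭_)
  open import Data.List.Relation.Binary.Permutation.Propositional.Properties using (map⁺)
  open import Data.Nat.ListAction using (sum)
  open import Data.Nat.ListAction.Properties using (sum-++; sum-↭)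
  open import Data.Sum using (inj₁; inj₂)
  open import Function using (_∘_)
  open import Relation.Binary.PropositionalEquality
  open ≡-Reasoning

  ∑ : ℕ → (ℕ → ℕ) → ℕ
  ∑ zero    f = 0
  ∑ (suc n) f = ∑ n f + f n

  sum-map-upTo : ∀ n (f : ℕ → ℕ) → sum (map f (upTo n)) ≡ ∑ n f
  sum-map-upTo zero    f = refl
  sum-map-upTo (suc n) f = begin
    sum (map f (upTo (suc n)))         ≡⟨ cong (sum ∘ map f) (upTo-∷ʳ n) ⟨
    sum (map f (upTo n ∷ʳ n))          ≡⟨ cong sum (map-++ f (upTo n) (n ∷ [])) ⟩
    sum (map f (upTo n) ++ (f n ∷ [])) ≡⟨ sum-++ (map f (upTo n)) (f n ∷ []) ⟩
    sum (map f (upTo n)) + (f n + 0)   ≡⟨ cong₂ _+_ (sum-map-upTo n f) (+-identityʳ (f n)) ⟩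
    ∑ n f + f n                        ∎

  ∑-cong : ∀ n {f g : ℕ → ℕ} → (∀ i → i < n → f i ≡ g i) → ∑ n f ≡ ∑ n g
  ∑-cong zero    eq = refl
  ∑-cong (suc n) eq = cong₂ _+_ (∑-cong n (λ i i<n → eq i (m<n⇒m<1+n i<n))) (eq n ≤-refl)

  ∑-*ˡ : ∀ n c (f : ℕ → ℕ) → ∑ n (λ i → c * f i) ≡ c * ∑ n f
  ∑-*ˡ zero    c f = sym (*-zeroʳ c)
  ∑-*ˡ (suc n) c f = trans (cong (_+ c * f n) (∑-*ˡ n c f)) (sym (*-distribˡ-+ c (∑ n f) (f n)))

  ∑-suc : ∀ n (f : ℕ → ℕ) → ∑ (suc n) f ≡ f 0 + ∑ n (f ∘ suc)
  ∑-suc zero    f = sym (+-identityʳ (f 0))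
  ∑-suc (suc n) f = trans (cong (_+ f (suc n)) (∑-suc n f)) (+-assoc (f 0) (∑ n (f ∘ suc)) (f (suc n)))

  ∑-extend : ∀ n K {f : ℕ → ℕ} → n ≤ K → (∀ i → n ≤ i → i < K → f i ≡ 0) → ∑ K f ≡ ∑ n f
  ∑-extend n zero    z≤n   _    = refl
  ∑-extend n (suc K) n≤1+K vanish with m≤n⇒m<n∨m≡n n≤1+K
  ... | inj₂ refl = refl
  ... | inj₁ n<1+K = begin
    ∑ K _ + _ ≡⟨ cong₂ _+_ (∑-extend n K n≤K (λ i n≤i i<K → vanish i n≤i (m<n⇒m<1+n i<K)))
                           (vanish K n≤K ≤-refl) ⟩
    ∑ n _ + 0 ≡⟨ +-identityʳ _ ⟩
    ∑ n _     ∎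
    where n≤K = s≤s⁻¹ n<1+K

  sum-map-∷ʳ : ∀ {A : Set} (f : A → ℕ) xs x → sum (map f (xs ∷ʳ x)) ≡ sum (map f xs) + f x
  sum-map-∷ʳ f xs x = begin
    sum (map f (xs ∷ʳ x))          ≡⟨ cong sum (map-++ f xs (x ∷ [])) ⟩
    sum (map f xs ++ f x ∷ [])     ≡⟨ sum-++ (map f xs) (f x ∷ []) ⟩
    sum (map f xs) + (f x + 0)     ≡⟨ cong (sum (map f xs) +_) (+-identityʳ (f x)) ⟩
    sum (map f xs) + f x           ∎

  sum-map-+ : ∀ {A : Set} (f g : A → ℕ) xs → sum (map (λ x → f x + g x) xs) ≡ sum (map f xs) + sum (map g xs)
  sum-map-+ f g []       = refl
  sum-map-+ f g (x ∷ xs) rewrite sum-map-+ f g xs = interchange (f x) (g x) (sum (map f xs)) (sum (map g xs))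
    where interchange : ∀ a b c d → a + b + (c + d) ≡ a + c + (b + d)
          interchange = solve-∀

  sum-map-zero : ∀ {A : Set} {P : A → Set} {f : A → ℕ} {xs} → All P xs → (∀ x → P x → f x ≡ 0) → sum (map f xs) ≡ 0
  sum-map-zero []         _     = refl
  sum-map-zero (px ∷ pxs) zeros rewrite zeros _ px = sum-map-zero pxs zeros

  sum-map-zero′ : ∀ {A : Set} {f : A → ℕ} → (∀ x → f x ≡ 0) → ∀ xs → sum (map f xs) ≡ 0
  sum-map-zero′ zeros []       = refl
  sum-map-zero′ zeros (x ∷ xs) rewrite zeros x = sum-map-zero′ zeros xs

  sum-map-↭ : ∀ {A : Set} (f : A → ℕ) {xs ys} → xs ↭ ys → sum (map f xs) ≡ sum (map f ys)
  sum-map-↭ f xs↭ys = sum-↭ (map⁺ f xs↭ys)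

  sum-map-upTo-single : ∀ N (F : ℕ → ℕ) c → c < N → (∀ d → d < N → d ≢ c → F d ≡ 0) → sum (map F (upTo N)) ≡ F c
  sum-map-upTo-single N F c c<N others = begin
    sum (map F (upTo N)) ≡⟨ sum-map-upTo N F ⟩
    ∑ N F                ≡⟨ ∑-single N ≤-refl c<N ⟩
    F c                  ∎
    where
    ∑-single : ∀ M → M ≤ N → c < M → ∑ M F ≡ F c
    ∑-single (suc M) M<N c<1+M with m≤n⇒m<n∨m≡n (s≤s⁻¹ c<1+M)
    ... | inj₁ c<M  = trans (cong₂ _+_ (∑-single M (<⇒≤ M<N) c<M) (others M M<N (>⇒≢ c<M))) (+-identityʳ (F c))
    ... | inj₂ refl = cong (_+ F c) (∑-extend 0 c z≤n (λ d _ d<c → others d (<-trans d<c c<N) (<⇒≢ d<c)))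

  sum-concatMap : ∀ {A : Set} (g : A → List ℕ) xs → sum (concatMap g xs) ≡ sum (map (sum ∘ g) xs)
  sum-concatMap g []       = refl
  sum-concatMap g (x ∷ xs) = trans (sum-++ (g x) (concatMap g xs)) (cong (sum (g x) +_) (sum-concatMap g xs))

  sum-map-concatMap : ∀ {A B : Set} (g : B → ℕ) (h : A → List B) xs →
    sum (map g (concatMap h xs)) ≡ sum (map (λ x → sum (map g (h x))) xs)
  sum-map-concatMap g h xs = trans (cong sum (map-concatMap g h xs)) (sum-concatMap (map g ∘ h) xs)


module PowerSeries where

  open import Data.Nat
  open import Data.Nat.Properties
  open import Data.Nat.Tactic.RingSolver using (solve-∀)
  open import Function using (_∘_)
  open import Relation.Binary.PropositionalEquality
  open ≡-Reasoning
  open FiniteSums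

  infixl 7 _⋆_

  -- The Cauchy product: (f ⋆ g) n = Σ_{i ≤ n} f i * g (n ∸ i).
  _⋆_ : Series → Series → Series
  (f ⋆ g) zero    = f 0 * g 0
  (f ⋆ g) (suc n) = f 0 * g (suc n) + (f ∘ suc ⋆ g) n

  z·_ : Series → Series
  (z· f) zero    = 0
  (z· f) (suc n) = f n

  ⋆-congˡ : ∀ n {f f′ g : Series} → (∀ i → i ≤ n → f i ≡ f′ i) → (f ⋆ g) n ≡ (f′ ⋆ g) n
  ⋆-congˡ zero    {g = g} eq = cong (_* g 0) (eq 0 z≤n)
  ⋆-congˡ (suc n) {g = g} eq =
    cong₂ _+_ (cong (_* g (suc n)) (eq 0 z≤n)) (⋆-congˡ n (λ i i≤n → eq (suc i) (s≤s i≤n)))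

  ⋆-congʳ : ∀ n {f g g′ : Series} → (∀ i → i ≤ n → g i ≡ g′ i) → (f ⋆ g) n ≡ (f ⋆ g′) n
  ⋆-congʳ zero    {f} eq = cong (f 0 *_) (eq 0 z≤n)
  ⋆-congʳ (suc n) {f} eq =
    cong₂ _+_ (cong (f 0 *_) (eq (suc n) ≤-refl)) (⋆-congʳ n (λ i i≤n → eq i (m≤n⇒m≤1+n i≤n)))

  ⋆-distribʳ-+ : ∀ n (f f′ g : Series) → ((λ i → f i + f′ i) ⋆ g) n ≡ (f ⋆ g) n + (f′ ⋆ g) n
  ⋆-distribʳ-+ zero    f f′ g = *-distribʳ-+ (g 0) (f 0) (f′ 0)
  ⋆-distribʳ-+ (suc n) f f′ g
    rewrite ⋆-distribʳ-+ n (f ∘ suc) (f′ ∘ suc) g | *-distribʳ-+ (g (suc n)) (f 0) (f′ 0) =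
    interchange (f 0 * g (suc n)) (f′ 0 * g (suc n)) ((f ∘ suc ⋆ g) n) ((f′ ∘ suc ⋆ g) n)
    where interchange : ∀ a b c d → a + b + (c + d) ≡ a + c + (b + d)
          interchange = solve-∀

  ⋆-distribˡ-+ : ∀ n (f g g′ : Series) → (f ⋆ (λ i → g i + g′ i)) n ≡ (f ⋆ g) n + (f ⋆ g′) n
  ⋆-distribˡ-+ zero    f g g′ = *-distribˡ-+ (f 0) (g 0) (g′ 0)
  ⋆-distribˡ-+ (suc n) f g g′
    rewrite ⋆-distribˡ-+ n (f ∘ suc) g g′ | *-distribˡ-+ (f 0) (g (suc n)) (g′ (suc n)) =
    interchange (f 0 * g (suc n)) (f 0 * g′ (suc n)) ((f ∘ suc ⋆ g) n) ((f ∘ suc ⋆ g′) n)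
    where interchange : ∀ a b c d → a + b + (c + d) ≡ a + c + (b + d)
          interchange = solve-∀

  ⋆-*ˡ : ∀ n c (f g : Series) → ((λ i → c * f i) ⋆ g) n ≡ c * (f ⋆ g) n
  ⋆-*ˡ zero    c f g = *-assoc c (f 0) (g 0)
  ⋆-*ˡ (suc n) c f g rewrite ⋆-*ˡ n c (f ∘ suc) g | *-assoc c (f 0) (g (suc n)) =
    sym (*-distribˡ-+ c (f 0 * g (suc n)) ((f ∘ suc ⋆ g) n))

  ⋆-*ʳ : ∀ n c (f g : Series) → (f ⋆ (λ i → c * g i)) n ≡ c * (f ⋆ g) n
  ⋆-*ʳ zero    c f g = lemma (f 0) c (g 0)
    where lemma : ∀ a b d → a * (b * d) ≡ b * (a * d)
          lemma = solve-∀
  ⋆-*ʳ (suc n) c f g rewrite ⋆-*ʳ n c (f ∘ suc) g = lemma (f 0) c (g (suc n)) ((f ∘ suc ⋆ g) n)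
    where lemma : ∀ a b d e → a * (b * d) + b * e ≡ b * (a * d + e)
          lemma = solve-∀

  ⋆-zeroʳ : ∀ n (f : Series) → (f ⋆ (λ _ → 0)) n ≡ 0
  ⋆-zeroʳ zero    f = *-zeroʳ (f 0)
  ⋆-zeroʳ (suc n) f rewrite ⋆-zeroʳ n (f ∘ suc) | *-zeroʳ (f 0) = refl

  ⋆-∑ʳ : ∀ n K (f : Series) (g : ℕ → Series) → (f ⋆ (λ m → ∑ K (λ k → g k m))) n ≡ ∑ K (λ k → (f ⋆ g k) n)
  ⋆-∑ʳ n zero    f g = ⋆-zeroʳ n f
  ⋆-∑ʳ n (suc K) f g rewrite ⋆-distribˡ-+ n f (λ m → ∑ K (λ k → g k m)) (g K) | ⋆-∑ʳ n K f g = refl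

  ⋆-z·ˡ : ∀ n (f g : Series) → (z· f ⋆ g) n ≡ (z· (f ⋆ g)) n
  ⋆-z·ˡ zero    f g = refl
  ⋆-z·ˡ (suc n) f g = refl

  ⋆-z·ʳ : ∀ n (f g : Series) → (f ⋆ z· g) n ≡ (z· (f ⋆ g)) n
  ⋆-z·ʳ zero          f g = *-zeroʳ (f 0)
  ⋆-z·ʳ (suc zero)    f g rewrite *-zeroʳ (f 1) = +-identityʳ (f 0 * g 0)
  ⋆-z·ʳ (suc (suc n)) f g rewrite ⋆-z·ʳ (suc n) (f ∘ suc) g = refl

  ⋆-assoc : ∀ n (f g h : Series) → (f ⋆ g ⋆ h) n ≡ (f ⋆ (g ⋆ h)) n
  ⋆-assoc zero    f g h = *-assoc (f 0) (g 0) (h 0)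
  ⋆-assoc (suc n) f g h = begin
    (f ⋆ g) 0 * h (suc n) + ((f ⋆ g) ∘ suc ⋆ h) n
      ≡⟨ cong ((f ⋆ g) 0 * h (suc n) +_) (⋆-distribʳ-+ n (λ i → f 0 * g (suc i)) (f ∘ suc ⋆ g) h) ⟩
    (f ⋆ g) 0 * h (suc n) + (((λ i → f 0 * g (suc i)) ⋆ h) n + (f ∘ suc ⋆ g ⋆ h) n)
      ≡⟨ cong₂ (λ a b → (f ⋆ g) 0 * h (suc n) + (a + b)) (⋆-*ˡ n (f 0) (g ∘ suc) h) (⋆-assoc n (f ∘ suc) g h) ⟩
    f 0 * g 0 * h (suc n) + (f 0 * (g ∘ suc ⋆ h) n + (f ∘ suc ⋆ (g ⋆ h)) n)
      ≡⟨ lemma (f 0) (g 0) (h (suc n)) ((g ∘ suc ⋆ h) n) ((f ∘ suc ⋆ (g ⋆ h)) n) ⟩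
    f 0 * (g 0 * h (suc n) + (g ∘ suc ⋆ h) n) + (f ∘ suc ⋆ (g ⋆ h)) n ∎
    where lemma : ∀ a b c d e → a * b * c + (a * d + e) ≡ a * (b * c + d) + e
          lemma = solve-∀

  mulS≡⋆ : ∀ n (f g : Series) → mulS f g n ≡ (f ⋆ g) n
  mulS≡⋆ n f g = trans (sum-map-upTo (suc n) (λ i → f i * g (n ∸ i))) (antidiagonal n f g)
    where
    antidiagonal : ∀ n (f g : Series) → ∑ (suc n) (λ i → f i * g (n ∸ i)) ≡ (f ⋆ g) n
    antidiagonal zero    f g = refl
    antidiagonal (suc n) f g rewrite ∑-suc (suc n) (λ i → f i * g (suc n ∸ i)) | antidiagonal n (f ∘ suc) g = refl

  ⋆-vanish : ∀ n (f g : Series) → f 0 ≡ 0 → (∀ j → j < n → g j ≡ 0) → (f ⋆ g) n ≡ 0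
  ⋆-vanish zero    f g f0≡0 _ rewrite f0≡0 = refl
  ⋆-vanish (suc n) f g f0≡0 g-vanish rewrite f0≡0 =
    trans (⋆-congʳ n (λ i i≤n → g-vanish i (s≤s i≤n))) (⋆-zeroʳ n (f ∘ suc))

  powS-vanish : ∀ (X : Series) → X 0 ≡ 0 → ∀ k m → m < k → powS X k m ≡ 0
  powS-vanish X X0≡0 (suc k) m m<1+k = trans (mulS≡⋆ m X (powS X k))
    (⋆-vanish m X (powS X k) X0≡0 (λ j j<m → powS-vanish X X0≡0 k j (≤-trans j<m (s≤s⁻¹ m<1+k))))

  geomS-truncate : ∀ (X : Series) → X 0 ≡ 0 → ∀ m K → m ≤ K → ∑ (suc K) (λ k → powS X k m) ≡ geomS X m
  geomS-truncate X X0≡0 m K m≤K =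
    trans (∑-extend (suc m) (suc K) (s≤s m≤K) (λ k m<k _ → powS-vanish X X0≡0 k m m<k))
          (sym (sum-map-upTo (suc m) (λ k → powS X k m)))

  -- G = 1/(1 - X) is characterised by G = 1 + X G.
  geomS-fixpoint : ∀ (X : Series) → X 0 ≡ 0 → ∀ n → geomS X (suc n) ≡ (X ∘ suc ⋆ geomS X) n
  geomS-fixpoint X X0≡0 n = begin
    geomS X (suc n)
      ≡⟨ sum-map-upTo (suc (suc n)) (λ k → powS X k (suc n)) ⟩
    ∑ (suc (suc n)) (λ k → powS X k (suc n))
      ≡⟨ ∑-suc (suc n) (λ k → powS X k (suc n)) ⟩
    0 + ∑ (suc n) (λ k → mulS X (powS X k) (suc n))
      ≡⟨ ∑-cong (suc n) (λ k _ → mulS≡⋆ (suc n) X (powS X k)) ⟩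
    ∑ (suc n) (λ k → (X ⋆ powS X k) (suc n))
      ≡⟨ ∑-cong (suc n) (λ k _ → cong (λ x → x * powS X k (suc n) + (X ∘ suc ⋆ powS X k) n) X0≡0) ⟩
    ∑ (suc n) (λ k → (X ∘ suc ⋆ powS X k) n)
      ≡⟨ ⋆-∑ʳ n (suc n) (X ∘ suc) (powS X) ⟨
    (X ∘ suc ⋆ (λ m → ∑ (suc n) (λ k → powS X k m))) n
      ≡⟨ ⋆-congʳ n (λ i i≤n → geomS-truncate X X0≡0 i n i≤n) ⟩
    (X ∘ suc ⋆ geomS X) n ∎


module JFraction (q p : ℕ) where

  open import Data.Nat
  open import Data.Nat.Properties
  open import Data.Bool using (if_then_else_)
  open import Data.Nat.Tactic.RingSolver using (solve-∀)
  open import Function using (_∘_)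
  open import Relation.Binary.PropositionalEquality hiding ([_])
  open ≡-Reasoning
  open PowerSeries

  [_] : ℕ → ℕ
  [ r ] = qpInt q p r

  b : ℕ → ℕ
  b h = [ suc h ] + 1

  T : ℕ → ℕ → Series
  T = cfTail q p

  T-suc : ∀ r h n → T (suc r) h (suc n) ≡ b h * T (suc r) h n + [ suc h ] * (z· (T r (suc h) ⋆ T (suc r) h)) n
  T-suc r h n = trans (geomS-fixpoint X X0≡0 n) (coefficient n)
    where
    X : Series
    X n = b h * (if n ≡ᵇ 1 then 1 else 0) + [ suc h ] * shift2 (T r (suc h)) n
    X0≡0 : X 0 ≡ 0
    X0≡0 rewrite *-zeroʳ (b h) | *-zeroʳ [ suc h ] = refl
    coefficient : ∀ n → (X ∘ suc ⋆ T (suc r) h) n ≡ b h * T (suc r) h n + [ suc h ] * (z· (T r (suc h) ⋆ T (suc r) h)) n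
    coefficient zero = lemma (b h) [ suc h ] (T (suc r) h 0)
      where lemma : ∀ β λ′ g → (β * 1 + λ′ * 0) * g ≡ β * g + λ′ * 0
            lemma = solve-∀
    coefficient (suc n) = cong₂ _+_ (lemma₁ (b h) [ suc h ] (T (suc r) h (suc n)))
      (trans (⋆-congˡ n (λ i _ → lemma₂ (b h) [ suc h ] (T r (suc h) i)))
             (⋆-*ˡ n [ suc h ] (T r (suc h)) (T (suc r) h)))
      where lemma₁ : ∀ β λ′ g → (β * 1 + λ′ * 0) * g ≡ β * g
            lemma₁ = solve-∀
            lemma₂ : ∀ β λ′ g → β * 0 + λ′ * g ≡ λ′ * g
            lemma₂ = solve-∀

  T-stable : ∀ j r r′ h → j < r → r ≤ r′ → T r h j ≡ T r′ h j
  T-stable j = bounded j j ≤-refl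
    where
    bounded : ∀ L j → j ≤ L → ∀ r r′ h → j < r → r ≤ r′ → T r h j ≡ T r′ h j
    bounded L       zero    _     (suc r) (suc r′) h _     _   = refl
    bounded (suc L) (suc j) j<1+L (suc r) (suc r′) h j<r 1+r≤1+r′ = begin
      T (suc r) h (suc j)
        ≡⟨ T-suc r h j ⟩
      b h * T (suc r) h j + [ suc h ] * (z· (T r (suc h) ⋆ T (suc r) h)) j
        ≡⟨ cong₂ (λ x y → b h * x + [ suc h ] * y)
                 (bounded L j j≤L (suc r) (suc r′) h (<-trans (n<1+n j) j<r) 1+r≤1+r′) (tails j j≤L (s≤s⁻¹ j<r)) ⟩
      b h * T (suc r′) h j + [ suc h ] * (z· (T r′ (suc h) ⋆ T (suc r′) h)) j
        ≡⟨ T-suc r′ h j ⟨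
      T (suc r′) h (suc j) ∎
      where
      j≤L = s≤s⁻¹ j<1+L
      r≤r′ = s≤s⁻¹ 1+r≤1+r′
      tails : ∀ k → k ≤ L → k < r → (z· (T r (suc h) ⋆ T (suc r) h)) k ≡ (z· (T r′ (suc h) ⋆ T (suc r′) h)) k
      tails zero    _     _   = refl
      tails (suc k) k<L k<r = trans
        (⋆-congˡ k (λ i i≤k → bounded L i (≤-trans i≤k (<⇒≤ k<L)) r r′ (suc h)
                                      (≤-trans (s≤s i≤k) (<⇒≤ k<r)) r≤r′))
        (⋆-congʳ k (λ i i≤k → bounded L i (≤-trans i≤k (<⇒≤ k<L)) (suc r) (suc r′) h
                                      (s≤s (≤-trans i≤k (<⇒≤ (<-trans (n<1+n k) k<r)))) 1+r≤1+r′))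

  -- The tail F_h of the infinite J-fraction; by T-stable its coefficient L is
  -- already correct at depth L + 1.
  F : ℕ → Series
  F h L = T (suc L) h L

  F-suc : ∀ h n → F h (suc n) ≡ b h * F h n + [ suc h ] * (z· (F (suc h) ⋆ F h)) n
  F-suc h n = trans (T-suc (suc n) h n)
    (cong₂ (λ x y → b h * x + [ suc h ] * y) (sym (T-stable n (suc n) (suc (suc n)) h ≤-refl (n≤1+n _))) (tails n ≤-refl))
    where
    tails : ∀ m → m ≤ n → (z· (T (suc n) (suc h) ⋆ T (suc (suc n)) h)) m ≡ (z· (F (suc h) ⋆ F h)) m
    tails zero    _     = refl
    tails (suc m) m<n = trans
      (⋆-congˡ m (λ i i≤m → sym (T-stable i (suc i) (suc n) (suc h) ≤-refl (s≤s (≤-trans i≤m (<⇒≤ m<n))))))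
      (⋆-congʳ m (λ i i≤m → sym (T-stable i (suc i) (suc (suc n)) h ≤-refl
                                           (s≤s (≤-trans i≤m (<⇒≤ (<-trans m<n (n<1+n n))))))))

  -- Weighted Motzkin paths of length L from height j down to 0: rises weigh 1,
  -- a level step at height h weighs b h, a fall from height h + 1 weighs [ h + 1 ].
  motzkin : ℕ → ℕ → ℕ
  motzkin zero    zero    = 1
  motzkin (suc j) zero    = 0
  motzkin zero    (suc L) = b 0 * motzkin 0 L + motzkin 1 L
  motzkin (suc j) (suc L) = b (suc j) * motzkin (suc j) L + motzkin (suc (suc j)) L + [ suc j ] * motzkin j L

  -- Decomposing a path from height j by its first visits to j - 1, ..., 0 gives
  -- [ j ] ⋯ [ 1 ] z^j F_j ⋯ F_0 as its generating function.
  motzkinGF : ℕ → Series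
  motzkinGF zero    = F 0
  motzkinGF (suc j) = λ L → [ suc j ] * (z· (F (suc j) ⋆ motzkinGF j)) L

  motzkinGF-suc : ∀ j L → motzkinGF (suc j) (suc L)
    ≡ b (suc j) * motzkinGF (suc j) L + motzkinGF (suc (suc j)) L + [ suc j ] * motzkinGF j L
  motzkinGF-suc j zero = lemma [ suc j ] (motzkinGF j 0) (b (suc j)) [ suc (suc j) ]
    where lemma : ∀ λ₁ a β λ₂ → λ₁ * (1 * a) ≡ β * (λ₁ * 0) + λ₂ * 0 + λ₁ * a
          lemma = solve-∀
  motzkinGF-suc j (suc n) = begin
    λ₁ * (1 * G (suc n) + (F₁ ∘ suc ⋆ G) n)
      ≡⟨ cong (λ x → λ₁ * (1 * G (suc n) + x)) F₁-step ⟩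
    λ₁ * (1 * G (suc n) + (β * (F₁ ⋆ G) n + λ₂ * (z· (F₂ ⋆ (F₁ ⋆ G))) n))
      ≡⟨ lemma λ₁ (G (suc n)) β ((F₁ ⋆ G) n) λ₂ ((z· (F₂ ⋆ (F₁ ⋆ G))) n) ⟩
    β * (λ₁ * (F₁ ⋆ G) n) + λ₂ * (λ₁ * (z· (F₂ ⋆ (F₁ ⋆ G))) n) + λ₁ * G (suc n)
      ≡⟨ cong (λ x → β * (λ₁ * (F₁ ⋆ G) n) + λ₂ * x + λ₁ * G (suc n))
              (trans (⋆-*ʳ n λ₁ F₂ (z· (F₁ ⋆ G))) (cong (λ₁ *_) (⋆-z·ʳ n F₂ (F₁ ⋆ G)))) ⟨
    β * (λ₁ * (F₁ ⋆ G) n) + λ₂ * (F₂ ⋆ motzkinGF (suc j)) n + λ₁ * G (suc n) ∎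
    where
    λ₁ = [ suc j ]
    λ₂ = [ suc (suc j) ]
    β = b (suc j)
    F₁ = F (suc j)
    F₂ = F (suc (suc j))
    G = motzkinGF j
    lemma : ∀ λ₁ a β c λ₂ d → λ₁ * (1 * a + (β * c + λ₂ * d)) ≡ β * (λ₁ * c) + λ₂ * (λ₁ * d) + λ₁ * a
    lemma = solve-∀
    F₁-step : (F₁ ∘ suc ⋆ G) n ≡ β * (F₁ ⋆ G) n + λ₂ * (z· (F₂ ⋆ (F₁ ⋆ G))) n
    F₁-step = begin
      (F₁ ∘ suc ⋆ G) n
        ≡⟨ ⋆-congˡ n (λ i _ → F-suc (suc j) i) ⟩
      ((λ i → β * F₁ i + λ₂ * (z· (F₂ ⋆ F₁)) i) ⋆ G) n
        ≡⟨ ⋆-distribʳ-+ n _ _ G ⟩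
      ((λ i → β * F₁ i) ⋆ G) n + ((λ i → λ₂ * (z· (F₂ ⋆ F₁)) i) ⋆ G) n
        ≡⟨ cong₂ _+_ (⋆-*ˡ n β F₁ G) (⋆-*ˡ n λ₂ (z· (F₂ ⋆ F₁)) G) ⟩
      β * (F₁ ⋆ G) n + λ₂ * (z· (F₂ ⋆ F₁) ⋆ G) n
        ≡⟨ cong (λ x → β * (F₁ ⋆ G) n + λ₂ * x)
                (trans (⋆-z·ˡ n (F₂ ⋆ F₁) G) (z·-cong n (λ i → ⋆-assoc i F₂ F₁ G))) ⟩
      β * (F₁ ⋆ G) n + λ₂ * (z· (F₂ ⋆ (F₁ ⋆ G))) n ∎
      where
      z·-cong : ∀ n {f g : Series} → (∀ i → f i ≡ g i) → (z· f) n ≡ (z· g) n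
      z·-cong zero    eq = refl
      z·-cong (suc n) eq = eq n

  motzkinGF≡motzkin : ∀ L j → motzkinGF j L ≡ motzkin j L
  motzkinGF≡motzkin zero    zero    = refl
  motzkinGF≡motzkin zero    (suc j) = *-zeroʳ [ suc j ]
  motzkinGF≡motzkin (suc L) zero    =
    trans (F-suc 0 L) (cong₂ (λ x y → b 0 * x + y) (motzkinGF≡motzkin L 0) (motzkinGF≡motzkin L 1))
  motzkinGF≡motzkin (suc L) (suc j) = trans (motzkinGF-suc j L)
    (cong₂ _+_ (cong₂ (λ x y → b (suc j) * x + y) (motzkinGF≡motzkin L (suc j)) (motzkinGF≡motzkin L (suc (suc j))))
               (cong ([ suc j ] *_) (motzkinGF≡motzkin L j)))

  convergent≡motzkin : ∀ D l → l < D → convergent q p D l ≡ motzkin 0 l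
  convergent≡motzkin D l l<D = trans (sym (T-stable l (suc l) D 0 ≤-refl l<D)) (motzkinGF≡motzkin l 0)


module CharlierPaths (q p : ℕ) where

  open import Data.Nat
  open import Data.Nat.Properties
  open import Data.Nat.Tactic.RingSolver using (solve-∀)
  open import Relation.Binary.PropositionalEquality hiding ([_])
  open ≡-Reasoning
  open FiniteSums
  open JFraction q p using ([_]; b; motzkin)

  [suc]≡ : ∀ h → [ suc h ] ≡ q ^ h + p * [ h ]
  [suc]≡ h = begin
    [ suc h ]
      ≡⟨ sum-map-upTo (suc h) (λ i → q ^ i * p ^ (suc h ∸ suc i)) ⟩
    ∑ h (λ i → q ^ i * p ^ (h ∸ i)) + q ^ h * p ^ (h ∸ h)
      ≡⟨ cong₂ _+_ lower (cong (λ k → q ^ h * p ^ k) (n∸n≡0 h)) ⟩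
    p * ∑ h (λ i → q ^ i * p ^ (h ∸ suc i)) + q ^ h * 1
      ≡⟨ cong₂ _+_ (cong (p *_) (sym (sum-map-upTo h _))) (*-identityʳ (q ^ h)) ⟩
    p * [ h ] + q ^ h
      ≡⟨ +-comm (p * [ h ]) (q ^ h) ⟩
    q ^ h + p * [ h ] ∎
    where
    lower : ∑ h (λ i → q ^ i * p ^ (h ∸ i)) ≡ p * ∑ h (λ i → q ^ i * p ^ (h ∸ suc i))
    lower = trans (∑-cong h (λ i i<h → trans (cong (λ k → q ^ i * p ^ k) (+-∸-assoc 1 i<h))
                                             (swap p (q ^ i) (p ^ (h ∸ suc i)))))
                  (∑-*ˡ h p (λ i → q ^ i * p ^ (h ∸ suc i)))
      where swap : ∀ p a c → a * (p * c) ≡ p * (a * c)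
            swap = solve-∀

  -- Weighted Motzkin paths of length L from height h down to 0, with level
  -- weight 1 + [ h ] and fall weight [ h ] at height h.
  charlier : ℕ → ℕ → ℕ
  charlier zero    zero    = 1
  charlier (suc h) zero    = 0
  charlier zero    (suc L) = (1 + [ 0 ]) * charlier 0 L + charlier 1 L
  charlier (suc h) (suc L) = (1 + [ suc h ]) * charlier (suc h) L + charlier (suc (suc h)) L + [ suc h ] * charlier h L

  charlier-suc : ∀ L h → charlier h (suc L) ≡ motzkin h L + [ h ] * motzkin (pred h) L
  charlier-suc zero zero = refl
  charlier-suc zero (suc zero) = lemma [ 1 ]
    where lemma : ∀ a → (1 + a) * 0 + 0 + a * 1 ≡ 0 + a * 1
          lemma = solve-∀
  charlier-suc zero (suc (suc h)) = lemma [ suc (suc h) ]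
    where lemma : ∀ a → (1 + a) * 0 + 0 + a * 0 ≡ 0 + a * 0
          lemma = solve-∀
  charlier-suc (suc L) zero rewrite charlier-suc L 0 | charlier-suc L 1 = lemma [ 1 ] (motzkin 0 L) (motzkin 1 L)
    where lemma : ∀ a x₀ x₁ → (1 + 0) * (x₀ + 0) + (x₁ + a * x₀) ≡ (a + 1) * x₀ + x₁ + 0
          lemma = solve-∀
  charlier-suc (suc L) (suc zero) rewrite charlier-suc L 0 | charlier-suc L 1 | charlier-suc L 2 =
    lemma [ 1 ] [ 2 ] (motzkin 0 L) (motzkin 1 L) (motzkin 2 L)
    where lemma : ∀ a c x₀ x₁ x₂ → (1 + a) * (x₁ + a * x₀) + (x₂ + c * x₁) + a * (x₀ + 0)
                                  ≡ (c + 1) * x₁ + x₂ + a * x₀ + a * ((a + 1) * x₀ + x₁)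
          lemma = solve-∀
  charlier-suc (suc L) (suc (suc k))
    rewrite charlier-suc L (suc k) | charlier-suc L (suc (suc k)) | charlier-suc L (suc (suc (suc k))) =
    lemma [ suc k ] [ suc (suc k) ] [ suc (suc (suc k)) ]
          (motzkin k L) (motzkin (suc k) L) (motzkin (suc (suc k)) L) (motzkin (suc (suc (suc k))) L)
    where lemma : ∀ a c d x₀ x₁ x₂ x₃ → (1 + c) * (x₂ + c * x₁) + (x₃ + d * x₂) + c * (x₁ + a * x₀)
                                      ≡ (d + 1) * x₂ + x₃ + c * x₁ + c * ((c + 1) * x₁ + x₂ + a * x₀)
          lemma = solve-∀


-- A partition under construction is summarised, block by block (ordered by the
-- position of their last elements), by the pair (arcs passing over that last
-- element , arcs starting after it): appending the next element to a block
-- closes an arc whose new crossings and nestings are exactly these two counts.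
module BlockStates (q p : ℕ) where

  open import Data.Nat
  open import Data.Nat.Properties
  open import Data.Nat.Tactic.RingSolver using (solve-∀)
  open import Data.Product using (_×_; _,_)
  open import Data.List using (List; []; _∷_; _++_; map; _∷ʳ_)
  open import Data.List.Properties using (map-++)
  open import Function using (_∘_)
  open import Relation.Binary.PropositionalEquality hiding ([_])
  open ≡-Reasoning
  open JFraction q p using ([_])
  open CharlierPaths q p using ([suc]≡; charlier)

  Entry : Set
  Entry = ℕ × ℕ

  w : Entry → ℕ
  w (a , c) = q ^ a * p ^ c

  bumpCr : Entry → Entry
  bumpCr (a , c) = (suc a , c)

  bumpNe : Entry → Entry
  bumpNe (a , c) = (a , suc c)

  -- Appending to the block of the entry between pre and post moves that entry to
  -- the end as (0 , 0); the new arc starts beyond the last elements of the blocks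
  -- in pre and passes over those of the blocks in post.
  joinState : List Entry → List Entry → List Entry
  joinState pre post = (map bumpNe pre ++ map bumpCr post) ∷ʳ (0 , 0)

  joinWeight : (List Entry → ℕ) → List Entry → List Entry → ℕ
  joinWeight g pre []         = 0
  joinWeight g pre (x ∷ post) = w x * g (joinState pre post) + joinWeight g (pre ∷ʳ x) post

  -- The weight of adding L further elements to a partition in the given state.

  completionWeight : ℕ → List Entry → ℕ
  completionWeight zero    st = 1
  completionWeight (suc L) st = completionWeight L (st ∷ʳ (0 , 0)) + joinWeight (completionWeight L) [] st

  -- subsetSum xs f = Σ_{S ⊆ xs} (Π_{x ∈ S} w x) * f |S|
  subsetSum : List Entry → (ℕ → ℕ) → ℕ
  subsetSum []       f = f 0
  subsetSum (x ∷ xs) f = subsetSum xs f + w x * subsetSum xs (f ∘ suc)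

  subsetSum-cong : ∀ xs {f g : ℕ → ℕ} → (∀ h → f h ≡ g h) → subsetSum xs f ≡ subsetSum xs g
  subsetSum-cong []       eq = eq 0
  subsetSum-cong (x ∷ xs) eq = cong₂ (λ a c → a + w x * c) (subsetSum-cong xs eq) (subsetSum-cong xs (eq ∘ suc))

  subsetSum-+ : ∀ xs (f g : ℕ → ℕ) → subsetSum xs (λ h → f h + g h) ≡ subsetSum xs f + subsetSum xs g
  subsetSum-+ []       f g = refl
  subsetSum-+ (x ∷ xs) f g rewrite subsetSum-+ xs f g | subsetSum-+ xs (f ∘ suc) (g ∘ suc) =
    lemma (subsetSum xs f) (subsetSum xs g) (w x) (subsetSum xs (f ∘ suc)) (subsetSum xs (g ∘ suc))
    where lemma : ∀ a b c d e → a + b + c * (d + e) ≡ a + c * d + (b + c * e)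
          lemma = solve-∀

  subsetSum-*ˡ : ∀ xs c (f : ℕ → ℕ) → subsetSum xs (λ h → c * f h) ≡ c * subsetSum xs f
  subsetSum-*ˡ []       c f = refl
  subsetSum-*ˡ (x ∷ xs) c f rewrite subsetSum-*ˡ xs c f | subsetSum-*ˡ xs c (f ∘ suc) =
    lemma c (subsetSum xs f) (w x) (subsetSum xs (f ∘ suc))
    where lemma : ∀ c a b d → c * a + b * (c * d) ≡ c * (a + b * d)
          lemma = solve-∀

  subsetSum-zero : ∀ xs → subsetSum xs (λ _ → 0) ≡ 0
  subsetSum-zero []       = refl
  subsetSum-zero (x ∷ xs) rewrite subsetSum-zero xs = *-zeroʳ (w x)

  subsetSum-∷ʳ : ∀ xs y (f : ℕ → ℕ) → subsetSum (xs ∷ʳ y) f ≡ subsetSum xs (λ h → f h + w y * f (suc h))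
  subsetSum-∷ʳ []       y f = refl
  subsetSum-∷ʳ (x ∷ xs) y f rewrite subsetSum-∷ʳ xs y f | subsetSum-∷ʳ xs y (f ∘ suc) = refl

  subsetSum-++ : ∀ xs ys (f : ℕ → ℕ) → subsetSum (xs ++ ys) f ≡ subsetSum xs (λ h → subsetSum ys (λ h′ → f (h + h′)))
  subsetSum-++ []       ys f = refl
  subsetSum-++ (x ∷ xs) ys f rewrite subsetSum-++ xs ys f | subsetSum-++ xs ys (f ∘ suc) = refl

  subsetSum-bumpCr : ∀ xs (f : ℕ → ℕ) → subsetSum (map bumpCr xs) f ≡ subsetSum xs (λ h → q ^ h * f h)
  subsetSum-bumpCr []             f = sym (*-identityˡ (f 0))
  subsetSum-bumpCr (x@(a , c) ∷ xs) f rewrite subsetSum-bumpCr xs f | subsetSum-bumpCr xs (f ∘ suc) =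
    cong (subsetSum xs (λ h → q ^ h * f h) +_) (begin
      q * q ^ a * p ^ c * subsetSum xs (λ h → q ^ h * f (suc h))
        ≡⟨ lemma q (q ^ a) (p ^ c) _ ⟩
      w x * (q * subsetSum xs (λ h → q ^ h * f (suc h)))
        ≡⟨ cong (w x *_) (subsetSum-*ˡ xs q (λ h → q ^ h * f (suc h))) ⟨
      w x * subsetSum xs (λ h → q * (q ^ h * f (suc h)))
        ≡⟨ cong (w x *_) (subsetSum-cong xs (λ h → *-assoc q (q ^ h) (f (suc h)))) ⟨
      w x * subsetSum xs (λ h → q * q ^ h * f (suc h))                ∎)
    where lemma : ∀ q u v s → q * u * v * s ≡ u * v * (q * s)
          lemma = solve-∀

  subsetSum-charlier-zero : ∀ xs → subsetSum xs (λ h → charlier h 0) ≡ 1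
  subsetSum-charlier-zero []       = refl
  subsetSum-charlier-zero (x ∷ xs) rewrite subsetSum-charlier-zero xs | subsetSum-zero xs | *-zeroʳ (w x) = refl

  joinWeight-cong : ∀ pre post {g g′ : List Entry → ℕ} → (∀ ys → g ys ≡ g′ ys) →
    joinWeight g pre post ≡ joinWeight g′ pre post
  joinWeight-cong pre []         eq = refl
  joinWeight-cong pre (x ∷ post) eq = cong₂ _+_ (cong (w x *_) (eq _)) (joinWeight-cong (pre ∷ʳ x) post eq)

  w-bumpNe : ∀ x → w (bumpNe x) ≡ p * w x
  w-bumpNe (a , c) = lemma p (q ^ a) (p ^ c)
    where lemma : ∀ p u v → u * (p * v) ≡ p * (u * v)
          lemma = solve-∀

  joinSubsetSum : List Entry → List Entry → (ℕ → ℕ) → ℕ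
  joinSubsetSum pre []         f = 0
  joinSubsetSum pre (x ∷ post) f = w x * subsetSum (map bumpNe pre ++ map bumpCr post) f + joinSubsetSum (pre ∷ʳ x) post f

  joinWeight-subsetSum : ∀ pre post (f : ℕ → ℕ) →
    joinWeight (λ ys → subsetSum ys f) pre post ≡ joinSubsetSum pre post (λ h → f h + 1 * f (suc h))
  joinWeight-subsetSum pre []         f = refl
  joinWeight-subsetSum pre (x ∷ post) f =
    cong₂ _+_ (cong (w x *_) (subsetSum-∷ʳ (map bumpNe pre ++ map bumpCr post) (0 , 0) f)) (joinWeight-subsetSum (pre ∷ʳ x) post f)

  joinSubsetSum≡ : ∀ post pre (f : ℕ → ℕ) →
    joinSubsetSum pre post f ≡ subsetSum (map bumpNe pre) (λ h → subsetSum post (λ h′ → [ h′ ] * f (h + pred h′)))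
  joinSubsetSum≡ []         pre f = sym (subsetSum-zero (map bumpNe pre))
  joinSubsetSum≡ (x ∷ post) pre f = begin
    w x * subsetSum (map bumpNe pre ++ map bumpCr post) f + joinSubsetSum (pre ∷ʳ x) post f
      ≡⟨ cong₂ _+_ (cong (w x *_) (trans (subsetSum-++ (map bumpNe pre) (map bumpCr post) f)
                     (subsetSum-cong (map bumpNe pre) (λ h → subsetSum-bumpCr post (λ h′ → f (h + h′))))))
                   (trans (joinSubsetSum≡ post (pre ∷ʳ x) f) (trans (cong (λ ys → subsetSum ys G) (map-++ bumpNe pre (x ∷ [])))
                     (subsetSum-∷ʳ (map bumpNe pre) (bumpNe x) G))) ⟩
    w x * subsetSum (map bumpNe pre) A + subsetSum (map bumpNe pre) (λ h → G h + w (bumpNe x) * G (suc h))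
      ≡⟨ cong (_+ subsetSum (map bumpNe pre) (λ h → G h + w (bumpNe x) * G (suc h))) (subsetSum-*ˡ (map bumpNe pre) (w x) A) ⟨
    subsetSum (map bumpNe pre) (λ h → w x * A h) + subsetSum (map bumpNe pre) (λ h → G h + w (bumpNe x) * G (suc h))
      ≡⟨ subsetSum-+ (map bumpNe pre) _ _ ⟨
    subsetSum (map bumpNe pre) (λ h → w x * A h + (G h + w (bumpNe x) * G (suc h)))
      ≡⟨ subsetSum-cong (map bumpNe pre) pointwise ⟩
    subsetSum (map bumpNe pre) (λ h → G h + w x * subsetSum post (λ h′ → [ suc h′ ] * f (h + h′))) ∎
    where
    G : ℕ → ℕ
    G h = subsetSum post (λ h′ → [ h′ ] * f (h + pred h′))
    A : ℕ → ℕ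
    A h = subsetSum post (λ h′ → q ^ h′ * f (h + h′))
    shift : ∀ h h′ → [ h′ ] * f (h + h′) ≡ [ h′ ] * f (suc h + pred h′)
    shift h zero    = refl
    shift h (suc k) = cong (λ n → [ suc k ] * f n) (+-suc h k)
    -- the identity [ h′ + 1 ] = q ^ h′ + p * [ h′ ], under the sum over post
    pointwise : ∀ h → w x * A h + (G h + w (bumpNe x) * G (suc h))
                    ≡ G h + w x * subsetSum post (λ h′ → [ suc h′ ] * f (h + h′))
    pointwise h = begin
      w x * A h + (G h + w (bumpNe x) * G (suc h))
        ≡⟨ cong (λ c → w x * A h + (G h + c * G (suc h))) (w-bumpNe x) ⟩
      w x * A h + (G h + p * w x * G (suc h))
        ≡⟨ lemma p (w x) (A h) (G h) (G (suc h)) ⟩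
      G h + w x * (A h + p * G (suc h))
        ≡⟨ cong (λ c → G h + w x * (A h + c)) (subsetSum-*ˡ post p (λ h′ → [ h′ ] * f (suc h + pred h′))) ⟨
      G h + w x * (A h + subsetSum post (λ h′ → p * ([ h′ ] * f (suc h + pred h′))))
        ≡⟨ cong (λ c → G h + w x * c) (subsetSum-+ post _ _) ⟨
      G h + w x * subsetSum post (λ h′ → q ^ h′ * f (h + h′) + p * ([ h′ ] * f (suc h + pred h′)))
        ≡⟨ cong (λ c → G h + w x * c) (subsetSum-cong post (λ h′ →
             trans (cong (λ c → q ^ h′ * f (h + h′) + p * c) (sym (shift h h′)))
                   (trans (collect (q ^ h′) (p * [ h′ ]) (f (h + h′)) p [ h′ ])
                          (cong (_* f (h + h′)) (sym ([suc]≡ h′)))))) ⟩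
      G h + w x * subsetSum post (λ h′ → [ suc h′ ] * f (h + h′)) ∎
      where
      lemma : ∀ p a b c d → a * b + (c + p * a * d) ≡ c + a * (b + p * d)
      lemma = solve-∀
      collect : ∀ a b c p′ k → a * c + p′ * (k * c) ≡ (a + p′ * k) * c
      collect = solve-∀

  completionWeight≡subsetSum : ∀ L st → completionWeight L st ≡ subsetSum st (λ h → charlier h L)
  completionWeight≡subsetSum zero    st = sym (subsetSum-charlier-zero st)
  completionWeight≡subsetSum (suc L) st = begin
    completionWeight L (st ∷ʳ (0 , 0)) + joinWeight (completionWeight L) [] st
      ≡⟨ cong₂ _+_ (trans (completionWeight≡subsetSum L (st ∷ʳ (0 , 0))) (subsetSum-∷ʳ st (0 , 0) g))
                   (trans (joinWeight-cong [] st (completionWeight≡subsetSum L))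
                          (trans (joinWeight-subsetSum [] st g) (joinSubsetSum≡ st [] g̃))) ⟩
    subsetSum st g̃ + subsetSum st (λ h′ → [ h′ ] * g̃ (pred h′)) ≡⟨ subsetSum-+ st _ _ ⟨
    subsetSum st (λ h → g̃ h + [ h ] * g̃ (pred h))              ≡⟨ subsetSum-cong st charlier-step ⟩
    subsetSum st (λ h → charlier h (suc L))                    ∎
    where
    g : ℕ → ℕ
    g h = charlier h L
    g̃ : ℕ → ℕ
    g̃ h = g h + 1 * g (suc h)
    charlier-step : ∀ h → g̃ h + [ h ] * g̃ (pred h) ≡ charlier h (suc L)
    charlier-step zero    = lemma (g 0) (g 1)
      where lemma : ∀ a b → a + 1 * b + 0 * (a + 1 * b) ≡ (1 + 0) * a + b
            lemma = solve-∀
    charlier-step (suc k) = lemma [ suc k ] (g k) (g (suc k)) (g (suc (suc k)))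
      where lemma : ∀ c a b d → b + 1 * d + c * (a + 1 * b) ≡ (1 + c) * b + d + c * a
            lemma = solve-∀


module Arcs where

  open import Data.Nat
  open import Data.Nat.Properties
  open import Data.Bool using (Bool; true; false; _∧_; not; if_then_else_)
  open import Data.Bool.Properties using (∧-zeroʳ; ∧-identityʳ; T-≡)
  open import Data.Product using (_×_; _,_; proj₁; proj₂)
  open import Data.Sum using (_⊎_; inj₁; inj₂)
  open import Data.List using (List; []; _∷_; _++_; map; concatMap; concat; upTo; length; _∷ʳ_; applyUpTo)
  open import Data.List.Properties using (upTo-∷ʳ; concatMap-++; ++-identityʳ; length-++; ++-assoc; map-cong; map-cong-local)
  open import Data.List.Relation.Unary.All as All using (All; []; _∷_)
  open import Data.List.Relation.Unary.All.Properties using (concat⁺; map⁺; all-upTo)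
  open import Data.List.Relation.Binary.Permutation.Propositional using (_↭_; ↭-refl; ↭-trans; ↭-reflexive)
  import Data.List.Relation.Binary.Permutation.Propositional.Properties as ↭
  open import Data.Nat.ListAction using (sum)
  open import Data.Bool.ListAction using (and)
  open import Function using (_∘_)
  open import Function.Bundles using (Equivalence)
  open import Relation.Binary.PropositionalEquality
  open import Relation.Binary.Definitions using (tri<; tri≈; tri>)
  open import Relation.Nullary using (¬_; yes; no)
  open import Data.Empty using (⊥-elim)
  open Equivalence using (to; from)
  open ≡-Reasoning
  open FiniteSums

  <ᵇ-true : ∀ {m n} → m < n → (m <ᵇ n) ≡ true
  <ᵇ-true m<n = to T-≡ (<⇒<ᵇ m<n)

  <ᵇ-false : ∀ {m n} → ¬ (m < n) → (m <ᵇ n) ≡ false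
  <ᵇ-false {m} {n} m≮n with m <ᵇ n in eq
  ... | false = refl
  ... | true  = ⊥-elim (m≮n (<ᵇ⇒< m n (from T-≡ eq)))

  <ᵇ-sound : ∀ {m n} → (m <ᵇ n) ≡ true → m < n
  <ᵇ-sound {m} {n} eq = <ᵇ⇒< m n (from T-≡ eq)

  n<ᵇn : ∀ n → (n <ᵇ n) ≡ false
  n<ᵇn n = <ᵇ-false (n≮n n)

  ≡ᵇ-refl : ∀ n → (n ≡ᵇ n) ≡ true
  ≡ᵇ-refl n = to T-≡ (≡⇒≡ᵇ n n refl)

  ≡ᵇ-false : ∀ {m n} → m ≢ n → (m ≡ᵇ n) ≡ false
  ≡ᵇ-false {m} {n} m≢n with m ≡ᵇ n in eq
  ... | false = refl
  ... | true  = ⊥-elim (m≢n (≡ᵇ⇒≡ m n (from T-≡ eq)))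

  ≡ᵇ-sound : ∀ {m n} → (m ≡ᵇ n) ≡ true → m ≡ n
  ≡ᵇ-sound {m} {n} eq = ≡ᵇ⇒≡ m n (from T-≡ eq)

  ∧-true₁ : ∀ {a b} → (a ∧ b) ≡ true → a ≡ true
  ∧-true₁ {true} _ = refl

  ∧-true₂ : ∀ a {b} → (a ∧ b) ≡ true → b ≡ true
  ∧-true₂ true eq = eq

  indicator : Bool → ℕ
  indicator b = if b then 1 else 0

  <∸⇒+< : ∀ n j t → t < j ∸ n → n + t < j
  <∸⇒+< zero    j       t t<j   = t<j
  <∸⇒+< (suc n) (suc j) t t<j∸n = s≤s (<∸⇒+< n j t t<j∸n)

  at-++ˡ : ∀ s t i → i < length s → at (s ++ t) i ≡ at s i
  at-++ˡ (x ∷ s) t zero    _     = refl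
  at-++ˡ (x ∷ s) t (suc i) i<len = at-++ˡ s t i (s≤s⁻¹ i<len)

  at-++ʳ : ∀ s t i → at (s ++ t) (length s + i) ≡ at t i
  at-++ʳ []      t i = refl
  at-++ʳ (x ∷ s) t i = at-++ʳ s t i

  at-last : ∀ s c → at (s ++ c ∷ []) (length s) ≡ c
  at-last s c = trans (cong (at (s ++ c ∷ [])) (sym (+-identityʳ (length s)))) (at-++ʳ s (c ∷ []) 0)

  length-snoc : ∀ (s : List ℕ) c → length (s ++ c ∷ []) ≡ suc (length s)
  length-snoc s c = trans (length-++ s) (+-comm (length s) 1)

  map-upTo-cong : ∀ {A : Set} n {f g : ℕ → A} → (∀ i → i < n → f i ≡ g i) → map f (upTo n) ≡ map g (upTo n)
  map-upTo-cong n eq = map-cong-local (All.map (eq _) (all-upTo n))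

  concatMap-upTo-cong : ∀ {A : Set} n {f g : ℕ → List A} → (∀ i → i < n → f i ≡ g i) →
    concatMap f (upTo n) ≡ concatMap g (upTo n)
  concatMap-upTo-cong n eq = cong concat (map-upTo-cong n eq)

  concatMap-upTo-[] : ∀ {A : Set} n {f : ℕ → List A} → (∀ i → i < n → f i ≡ []) → concatMap f (upTo n) ≡ []
  concatMap-upTo-[] n eq = trans (concatMap-upTo-cong n eq) (concat-[] (upTo n))
    where
    concat-[] : ∀ {A : Set} (xs : List ℕ) → concatMap (λ _ → []) xs ≡ ([] {A = A})
    concat-[] []       = refl
    concat-[] (x ∷ xs) = concat-[] xs

  and-applyUpTo-true : ∀ n (g : ℕ → ℕ) (f : ℕ → Bool) → (∀ t → t < n → f (g t) ≡ true) →
    and (map f (applyUpTo g n)) ≡ true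
  and-applyUpTo-true zero    g f eq = refl
  and-applyUpTo-true (suc n) g f eq rewrite eq 0 z<s = and-applyUpTo-true n (g ∘ suc) f (λ t t<n → eq (suc t) (s≤s t<n))

  and-applyUpTo-false : ∀ n (g : ℕ → ℕ) (f : ℕ → Bool) t → t < n → f (g t) ≡ false →
    and (map f (applyUpTo g n)) ≡ false
  and-applyUpTo-false (suc n) g f zero    _     eq rewrite eq = refl
  and-applyUpTo-false (suc n) g f (suc t) t<1+n eq
    rewrite and-applyUpTo-false n (g ∘ suc) f t (s≤s⁻¹ t<1+n) eq = ∧-zeroʳ (f (g 0))

  all-upTo-true : ∀ n (f : ℕ → Bool) → (∀ t → t < n → f t ≡ true) → all f (upTo n) ≡ true
  all-upTo-true n f = and-applyUpTo-true n (λ x → x) f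

  all-upTo-false : ∀ n (f : ℕ → Bool) t → t < n → f t ≡ false → all f (upTo n) ≡ false
  all-upTo-false n f = and-applyUpTo-false n (λ x → x) f

  all-upTo-cong : ∀ n (f g : ℕ → Bool) → (∀ t → t < n → f t ≡ g t) → all f (upTo n) ≡ all g (upTo n)
  all-upTo-cong n f g eq = cong and (map-upTo-cong n eq)

  Fresh : List ℕ → ℕ → Set
  Fresh s c = ∀ i → i < length s → at s i ≢ c

  record LastOccurrence (s : List ℕ) (c pos : ℕ) : Set where
    field
      pos<length : pos < length s
      at-pos     : at s pos ≡ c
      later≢     : ∀ t → pos < t → t < length s → at s t ≢ c
  open LastOccurrence public

  arcAt : List ℕ → ℕ → ℕ → List (ℕ × ℕ)
  arcAt a i j = if isArc a i j then (i , j) ∷ [] else []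

  isArc-snoc-old : ∀ s c i j → i < length s → j < length s → isArc (s ++ c ∷ []) i j ≡ isArc s i j
  isArc-snoc-old s c i j i<m j<m =
    cong₂ (λ x y → (i <ᵇ j) ∧ x ∧ y) (cong₂ _≡ᵇ_ at-i (at-++ˡ s (c ∷ []) j j<m))
      (all-upTo-cong (j ∸ suc i) _ _ (λ t t<j∸1+i → cong₂ (λ u v → not (u ≡ᵇ v))
         (at-++ˡ s (c ∷ []) (suc i + t) (<-trans (<∸⇒+< (suc i) j t t<j∸1+i) j<m)) at-i))
    where at-i = at-++ˡ s (c ∷ []) i i<m

  isArc-backward : ∀ a m j → j ≤ m → isArc a m j ≡ false
  isArc-backward a m j j≤m rewrite <ᵇ-false {m} {j} (≤⇒≯ j≤m) = refl

  isArc-snoc-fresh : ∀ s c → Fresh s c → ∀ i → i < length s → isArc (s ++ c ∷ []) i (length s) ≡ false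
  isArc-snoc-fresh s c fresh i i<m
    rewrite <ᵇ-true i<m | at-++ˡ s (c ∷ []) i i<m | at-last s c | ≡ᵇ-false (fresh i i<m) = refl

  isArc-snoc-join : ∀ s c pos → LastOccurrence s c pos →
    ∀ i → i < length s → isArc (s ++ c ∷ []) i (length s) ≡ (i ≡ᵇ pos)
  isArc-snoc-join s c pos last i i<m rewrite <ᵇ-true i<m | at-++ˡ s (c ∷ []) i i<m | at-last s c with <-cmp i pos
  ... | tri≈ _ refl _ rewrite at-pos last | ≡ᵇ-refl c | ≡ᵇ-refl i =
    all-upTo-true (length s ∸ suc i) _ (λ t t< → cong not (trans
      (cong (_≡ᵇ c) (at-++ˡ s (c ∷ []) (suc i + t) (<∸⇒+< (suc i) (length s) t t<)))
      (≡ᵇ-false (later≢ last (suc i + t) (s≤s (m≤m+n i t)) (<∸⇒+< (suc i) (length s) t t<)))))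
  ... | tri> _ i≢pos pos<i rewrite ≡ᵇ-false (later≢ last i pos<i i<m) | ≡ᵇ-false i≢pos = refl
  ... | tri< i<pos i≢pos _ rewrite ≡ᵇ-false i≢pos with at s i ≟ c
  ...   | no  at-i≢c rewrite ≡ᵇ-false at-i≢c = refl
  ...   | yes at-i≡c rewrite at-i≡c | ≡ᵇ-refl c =
    all-upTo-false (length s ∸ suc i) _ (pos ∸ suc i) (∸-monoˡ-< (pos<length last) i<pos)
      (cong not (trans (cong (_≡ᵇ c) (trans (at-++ˡ s (c ∷ []) (suc i + (pos ∸ suc i)) (subst (_< length s) (sym (m+[n∸m]≡n i<pos)) (pos<length last)))
                                            (trans (cong (at s) (m+[n∸m]≡n i<pos)) (at-pos last))))
                       (≡ᵇ-refl c)))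

  concatMap-++-↭ : ∀ {A B : Set} (f g : A → List B) xs → concatMap (λ x → f x ++ g x) xs ↭ concatMap f xs ++ concatMap g xs
  concatMap-++-↭ f g []       = ↭-refl
  concatMap-++-↭ f g (x ∷ xs) =
    ↭-trans (↭.++⁺ˡ (f x ++ g x) (concatMap-++-↭ f g xs))
    (↭-trans (↭-reflexive (++-assoc (f x) (g x) _))
    (↭-trans (↭.++⁺ˡ (f x) (↭.shifts (g x) (concatMap f xs)))
             (↭-reflexive (sym (++-assoc (f x) (concatMap f xs) _)))))

  arcs-snoc : ∀ s c → arcs (s ++ c ∷ []) ↭ arcs s ++ concatMap (λ i → arcAt (s ++ c ∷ []) i (length s)) (upTo (length s))
  arcs-snoc s c rewrite length-snoc s c =
    ↭-trans (↭-reflexive rows) (↭-trans (↭-reflexive (++-identityʳ _)) (concatMap-++-↭ old new (upTo m)))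
    where
    m = length s
    s′ = s ++ c ∷ []
    row : ℕ → List (ℕ × ℕ)
    row i = concatMap (arcAt s′ i) (upTo (suc m))
    old : ℕ → List (ℕ × ℕ)
    old i = concatMap (arcAt s i) (upTo m)
    new : ℕ → List (ℕ × ℕ)
    new i = arcAt s′ i m
    row-old : ∀ i → i < m → row i ≡ old i ++ new i
    row-old i i<m = begin
      concatMap (arcAt s′ i) (upTo (suc m))           ≡⟨ cong (concatMap (arcAt s′ i)) (upTo-∷ʳ m) ⟨
      concatMap (arcAt s′ i) (upTo m ∷ʳ m)            ≡⟨ concatMap-++ (arcAt s′ i) (upTo m) (m ∷ []) ⟩
      concatMap (arcAt s′ i) (upTo m) ++ (new i ++ []) ≡⟨ cong₂ _++_ (concatMap-upTo-cong m (λ j j<m →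
                                                            cong (λ b → if b then (i , j) ∷ [] else []) (isArc-snoc-old s c i j i<m j<m)))
                                                          (++-identityʳ _) ⟩
      old i ++ new i                                   ∎
    row-new : row m ≡ []
    row-new = concatMap-upTo-[] (suc m) (λ j j<1+m → cong (λ b → if b then (m , j) ∷ [] else []) (isArc-backward s′ m j (s≤s⁻¹ j<1+m)))
    rows : concatMap row (upTo (suc m)) ≡ concatMap (λ i → old i ++ new i) (upTo m) ++ []
    rows = begin
      concatMap row (upTo (suc m))
        ≡⟨ cong (concatMap row) (upTo-∷ʳ m) ⟨
      concatMap row (upTo m ∷ʳ m)
        ≡⟨ concatMap-++ row (upTo m) (m ∷ []) ⟩
      concatMap row (upTo m) ++ (row m ++ [])
        ≡⟨ cong₂ _++_ (concatMap-upTo-cong m row-old) (cong (_++ []) row-new) ⟩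
      concatMap (λ i → old i ++ new i) (upTo m) ++ [] ∎

  concatMap-upTo-single : ∀ n m pos → pos < n →
    concatMap (λ i → if i ≡ᵇ pos then (i , m) ∷ [] else []) (upTo n) ≡ (pos , m) ∷ []
  concatMap-upTo-single (suc n) m pos pos<1+n = begin
    concatMap f (upTo (suc n))          ≡⟨ cong (concatMap f) (upTo-∷ʳ n) ⟨
    concatMap f (upTo n ∷ʳ n)           ≡⟨ concatMap-++ f (upTo n) (n ∷ []) ⟩
    concatMap f (upTo n) ++ (f n ++ []) ≡⟨ split (m≤n⇒m<n∨m≡n (s≤s⁻¹ pos<1+n)) ⟩
    (pos , m) ∷ []                      ∎
    where
    f : ℕ → List (ℕ × ℕ)
    f i = if i ≡ᵇ pos then (i , m) ∷ [] else []
    split : pos < n ⊎ pos ≡ n → concatMap f (upTo n) ++ (f n ++ []) ≡ (pos , m) ∷ []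
    split (inj₁ pos<n) = cong₂ _++_ (concatMap-upTo-single n m pos pos<n)
                                    (cong (λ b → (if b then (n , m) ∷ [] else []) ++ []) (≡ᵇ-false (>⇒≢ pos<n)))
    split (inj₂ refl)  = cong₂ _++_ (concatMap-upTo-[] n (λ i i<n → cong (λ b → if b then (i , m) ∷ [] else []) (≡ᵇ-false (<⇒≢ i<n))))
                                    (cong (λ b → (if b then (n , m) ∷ [] else []) ++ []) (≡ᵇ-refl n))

  arcs-snoc-fresh : ∀ s c → Fresh s c → arcs (s ++ c ∷ []) ↭ arcs s
  arcs-snoc-fresh s c fresh = ↭-trans (arcs-snoc s c) (↭-reflexive (trans
    (cong (arcs s ++_) (concatMap-upTo-[] (length s) (λ i i<m →
      cong (λ b → if b then (i , length s) ∷ [] else []) (isArc-snoc-fresh s c fresh i i<m))))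
    (++-identityʳ (arcs s))))

  arcs-snoc-join : ∀ s c pos → LastOccurrence s c pos → arcs (s ++ c ∷ []) ↭ arcs s ∷ʳ (pos , length s)
  arcs-snoc-join s c pos last = ↭-trans (arcs-snoc s c) (↭-reflexive (cong (arcs s ++_) (trans
    (concatMap-upTo-cong (length s) (λ i i<m →
      cong (λ b → if b then (i , length s) ∷ [] else []) (isArc-snoc-join s c pos last i i<m)))
    (concatMap-upTo-single (length s) (length s) pos (pos<length last)))))

  ArcWithin : ℕ → ℕ × ℕ → Set
  ArcWithin n (i , j) = i < j × j < n

  arcs-within : ∀ a → All (ArcWithin (length a)) (arcs a)
  arcs-within a = concat⁺ (map⁺ (All.map (λ {i} _ → concat⁺ (map⁺ (All.map (λ {j} → arcAt-within i j) (all-upTo (length a)))))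
                                         (all-upTo (length a))))
    where
    arcAt-within : ∀ i j → j < length a → All (ArcWithin (length a)) (arcAt a i j)
    arcAt-within i j j<n with isArc a i j in eq
    ... | true  = (<ᵇ-sound (∧-true₁ eq) , j<n) ∷ []
    ... | false = []

  pairCount : (ℕ × ℕ → ℕ × ℕ → Bool) → List (ℕ × ℕ) → List (ℕ × ℕ) → ℕ
  pairCount R xs ys = sum (map (λ x → sum (map (λ y → indicator (R x y)) ys)) xs)

  countPairs≡pairCount : ∀ R as → countPairs R as ≡ pairCount R as as
  countPairs≡pairCount R as = sum-concatMap (λ x → map (λ y → indicator (R x y)) as) as

  pairCount-↭ : ∀ R {xs xs′ ys ys′} → xs ↭ xs′ → ys ↭ ys′ → pairCount R xs ys ≡ pairCount R xs′ ys′
  pairCount-↭ R {xs} xs↭xs′ ys↭ys′ =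
    trans (cong sum (map-cong (λ x → sum-map-↭ (λ y → indicator (R x y)) ys↭ys′) xs)) (sum-map-↭ _ xs↭xs′)

  pairCount-∷ʳ : ∀ R xs z → pairCount R (xs ∷ʳ z) (xs ∷ʳ z)
    ≡ pairCount R xs xs + sum (map (λ y → indicator (R y z)) xs) + (sum (map (λ y → indicator (R z y)) xs) + indicator (R z z))
  pairCount-∷ʳ R xs z = trans (sum-map-∷ʳ _ xs z) (cong₂ _+_
    (trans (cong sum (map-cong (λ x → sum-map-∷ʳ (λ y → indicator (R x y)) xs z) xs)) (sum-map-+ _ _ xs))
    (sum-map-∷ʳ _ xs z))

  countPairs-↭ : ∀ R {xs ys} → xs ↭ ys → countPairs R xs ≡ countPairs R ys
  countPairs-↭ R {xs} {ys} xs↭ys =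
    trans (countPairs≡pairCount R xs) (trans (pairCount-↭ R xs↭ys xs↭ys) (sym (countPairs≡pairCount R ys)))

  arcsOver : ℕ → List (ℕ × ℕ) → ℕ
  arcsOver i A = sum (map (λ z → indicator ((proj₁ z <ᵇ i) ∧ (i <ᵇ proj₂ z))) A)

  arcsBeyond : ℕ → List (ℕ × ℕ) → ℕ
  arcsBeyond i A = sum (map (λ z → indicator (i <ᵇ proj₁ z)) A)

  arcsOver-top : ∀ a m → length a ≡ suc m → arcsOver m (arcs a) ≡ 0
  arcsOver-top a m len≡ = sum-map-zero (subst (λ n → All (ArcWithin n) (arcs a)) len≡ (arcs-within a)) (λ (x , y) (_ , y<1+m) →
    cong indicator (trans (cong ((x <ᵇ m) ∧_) (<ᵇ-false (≤⇒≯ (s≤s⁻¹ y<1+m)))) (∧-zeroʳ _)))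

  arcsBeyond-top : ∀ a m → length a ≡ suc m → arcsBeyond m (arcs a) ≡ 0
  arcsBeyond-top a m len≡ = sum-map-zero (subst (λ n → All (ArcWithin n) (arcs a)) len≡ (arcs-within a)) (λ (x , y) (x<y , y<1+m) →
    cong indicator (<ᵇ-false (≤⇒≯ (≤-trans (<⇒≤ x<y) (s≤s⁻¹ y<1+m)))))

  module FreshBlock (s : List ℕ) (c : ℕ) (fresh : Fresh s c) where

    cr-snoc : cr (s ++ c ∷ []) ≡ cr s
    cr-snoc = countPairs-↭ crossingRel (arcs-snoc-fresh s c fresh)

    ne-snoc : ne (s ++ c ∷ []) ≡ ne s
    ne-snoc = countPairs-↭ nestingRel (arcs-snoc-fresh s c fresh)

    arcsOver-snoc : ∀ i → arcsOver i (arcs (s ++ c ∷ [])) ≡ arcsOver i (arcs s)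
    arcsOver-snoc i = sum-map-↭ _ (arcs-snoc-fresh s c fresh)

    arcsBeyond-snoc : ∀ i → arcsBeyond i (arcs (s ++ c ∷ [])) ≡ arcsBeyond i (arcs s)
    arcsBeyond-snoc i = sum-map-↭ _ (arcs-snoc-fresh s c fresh)

  -- Appending c to its block adds the arc (pos , m): it crosses the arcs over
  -- pos, nests the arcs beyond pos, passes over the positions after pos and
  -- starts beyond the positions before pos.
  module JoinBlock (s : List ℕ) (c pos : ℕ) (last : LastOccurrence s c pos) where

    private
      m = length s
      A = arcs s
      new = (pos , m)
      perm : arcs (s ++ c ∷ []) ↭ A ∷ʳ new
      perm = arcs-snoc-join s c pos last

      withNewˡ : (ℕ × ℕ → ℕ × ℕ → Bool) → ℕ
      withNewˡ R = sum (map (λ y → indicator (R y new)) A)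
      withNewʳ : (ℕ × ℕ → ℕ × ℕ → Bool) → ℕ
      withNewʳ R = sum (map (λ y → indicator (R new y)) A) + indicator (R new new)

      countPairs-snoc : ∀ R → countPairs R (arcs (s ++ c ∷ [])) ≡ countPairs R A + withNewˡ R + withNewʳ R
      countPairs-snoc R = begin
        countPairs R (arcs (s ++ c ∷ []))
          ≡⟨ countPairs≡pairCount R (arcs (s ++ c ∷ [])) ⟩
        pairCount R (arcs (s ++ c ∷ [])) (arcs (s ++ c ∷ []))
          ≡⟨ pairCount-↭ R perm perm ⟩
        pairCount R (A ∷ʳ new) (A ∷ʳ new)
          ≡⟨ pairCount-∷ʳ R A new ⟩
        pairCount R A A + withNewˡ R + withNewʳ R
          ≡⟨ cong (λ n → n + withNewˡ R + withNewʳ R) (countPairs≡pairCount R A) ⟨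
        countPairs R A + withNewˡ R + withNewʳ R ∎

    cr-snoc : cr (s ++ c ∷ []) ≡ cr s + arcsOver pos A
    cr-snoc = begin
      cr (s ++ c ∷ [])          ≡⟨ countPairs-snoc crossingRel ⟩
      cr s + withNewˡ crossingRel + withNewʳ crossingRel ≡⟨ cong₂ (λ x y → cr s + x + y)
                                         (cong sum (map-cong-local (All.map (λ {z} → crossed-by-new z) (arcs-within s))))
                                         (cong₂ _+_ (sum-map-zero (arcs-within s) crosses-none)
                                                    (cong (λ b → indicator (b ∧ (pos <ᵇ m) ∧ (m <ᵇ m))) (n<ᵇn pos))) ⟩
      cr s + arcsOver pos A + 0 ≡⟨ +-identityʳ _ ⟩
      cr s + arcsOver pos A     ∎
      where
      crossed-by-new : ∀ z → ArcWithin m z → indicator (crossingRel z new) ≡ indicator ((proj₁ z <ᵇ pos) ∧ (pos <ᵇ proj₂ z))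
      crossed-by-new (x , y) (_ , y<m) rewrite <ᵇ-true y<m | ∧-identityʳ (pos <ᵇ y) = refl
      crosses-none : ∀ z → ArcWithin m z → indicator (crossingRel new z) ≡ 0
      crosses-none (x , y) (_ , y<m) rewrite <ᵇ-false (<⇒≯ y<m) | ∧-zeroʳ (x <ᵇ m) | ∧-zeroʳ (pos <ᵇ x) = refl

    ne-snoc : ne (s ++ c ∷ []) ≡ ne s + arcsBeyond pos A
    ne-snoc = begin
      ne (s ++ c ∷ [])              ≡⟨ countPairs-snoc nestingRel ⟩
      ne s + withNewˡ nestingRel + withNewʳ nestingRel ≡⟨ cong₂ (λ x y → ne s + x + y)
                                             (sum-map-zero (arcs-within s) nests-none)
                                             (cong₂ _+_ (cong sum (map-cong-local (All.map (λ {z} → nested-in-new z) (arcs-within s))))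
                                                        (cong (λ b → indicator (b ∧ (pos <ᵇ m) ∧ (m <ᵇ m))) (n<ᵇn pos))) ⟩
      ne s + 0 + (arcsBeyond pos A + 0) ≡⟨ cong₂ _+_ (+-identityʳ (ne s)) (+-identityʳ _) ⟩
      ne s + arcsBeyond pos A       ∎
      where
      nests-none : ∀ z → ArcWithin m z → indicator (nestingRel z new) ≡ 0
      nests-none (x , y) (_ , y<m) rewrite <ᵇ-false (<⇒≯ y<m) | ∧-zeroʳ (pos <ᵇ m) | ∧-zeroʳ (x <ᵇ pos) = refl
      nested-in-new : ∀ z → ArcWithin m z → indicator (nestingRel new z) ≡ indicator (pos <ᵇ proj₁ z)
      nested-in-new (x , y) (x<y , y<m) rewrite <ᵇ-true x<y | <ᵇ-true y<m | ∧-identityʳ (pos <ᵇ x) = refl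

    private
      arcsOver-snoc : ∀ i → arcsOver i (arcs (s ++ c ∷ [])) ≡ arcsOver i A + indicator ((pos <ᵇ i) ∧ (i <ᵇ m))
      arcsOver-snoc i = trans (sum-map-↭ _ perm) (sum-map-∷ʳ _ A new)

      arcsBeyond-snoc : ∀ i → arcsBeyond i (arcs (s ++ c ∷ [])) ≡ arcsBeyond i A + indicator (i <ᵇ pos)
      arcsBeyond-snoc i = trans (sum-map-↭ _ perm) (sum-map-∷ʳ _ A new)

    arcsOver-earlier : ∀ i → i < pos → arcsOver i (arcs (s ++ c ∷ [])) ≡ arcsOver i A
    arcsOver-earlier i i<pos rewrite arcsOver-snoc i | <ᵇ-false (<⇒≯ i<pos) = +-identityʳ _

    arcsBeyond-earlier : ∀ i → i < pos → arcsBeyond i (arcs (s ++ c ∷ [])) ≡ suc (arcsBeyond i A)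
    arcsBeyond-earlier i i<pos rewrite arcsBeyond-snoc i | <ᵇ-true i<pos = +-comm _ 1

    arcsOver-later : ∀ i → pos < i → i < m → arcsOver i (arcs (s ++ c ∷ [])) ≡ suc (arcsOver i A)
    arcsOver-later i pos<i i<m rewrite arcsOver-snoc i | <ᵇ-true pos<i | <ᵇ-true i<m = +-comm _ 1

    arcsBeyond-later : ∀ i → pos < i → arcsBeyond i (arcs (s ++ c ∷ [])) ≡ arcsBeyond i A
    arcsBeyond-later i pos<i rewrite arcsBeyond-snoc i | <ᵇ-false (<⇒≯ pos<i) = +-identityʳ _


module Insertion (q p : ℕ) where

  open import Data.Nat
  open import Data.Nat.Properties
  open import Data.Nat.Tactic.RingSolver using (solve-∀)
  open import Data.Bool using (if_then_else_)
  open import Data.Product using (_×_; _,_; proj₁; proj₂)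
  open import Data.Sum using (inj₁; inj₂)
  open import Data.List using (List; []; _∷_; _++_; map; concatMap; upTo; length; _∷ʳ_)
  open import Data.List.Properties using (upTo-∷ʳ; map-++; concatMap-++; ++-identityʳ; ++-assoc; map-∘; concatMap-pure; map-cong; map-cong-local)
  open import Data.List.Relation.Unary.All as All using (All; []; _∷_)
  open import Data.List.Relation.Unary.All.Properties using (++⁺; ++⁻)
  open import Data.List.Relation.Unary.AllPairs using (AllPairs; []; _∷_)
  import Data.List.Relation.Unary.AllPairs.Properties as AllPairs
  open import Relation.Nullary using (contradiction)
  open import Data.List.Relation.Binary.Permutation.Propositional using (_↭_; ↭-refl; ↭-sym; ↭-trans; ↭-reflexive)
  import Data.List.Relation.Binary.Permutation.Propositional.Properties as ↭
  open import Data.Nat.ListAction using (sum)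
  open import Function using (_∘_)
  open import Relation.Binary.PropositionalEquality
  open ≡-Reasoning
  open FiniteSums
  open Arcs
  open BlockStates q p using (Entry; w; joinState; joinWeight; completionWeight)

  W : List ℕ → ℕ
  W s = q ^ cr s * p ^ ne s

  -- Definitionally the step of rgsAux.
  extendRGS : List ℕ × ℕ → List (List ℕ × ℕ)
  extendRGS (s , k) = map (λ c → (s ++ c ∷ [] , (if c ≡ᵇ k then suc k else k))) (upTo (suc k))

  extensions : ℕ → List ℕ × ℕ → List (List ℕ × ℕ)
  extensions zero    x = x ∷ []
  extensions (suc L) x = concatMap (extensions L) (extendRGS x)

  extensionsWeight : ℕ → List ℕ × ℕ → ℕ
  extensionsWeight L x = sum (map (W ∘ proj₁) (extensions L x))

  concatMap-concatMap : ∀ {A B C : Set} (f : B → List C) (g : A → List B) xs →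
    concatMap f (concatMap g xs) ≡ concatMap (concatMap f ∘ g) xs
  concatMap-concatMap f g []       = refl
  concatMap-concatMap f g (x ∷ xs) =
    trans (concatMap-++ f (g x) (concatMap g xs)) (cong (concatMap f (g x) ++_) (concatMap-concatMap f g xs))

  extensions-rgsAux : ∀ L m → concatMap (extensions L) (rgsAux m) ≡ rgsAux (L + m)
  extensions-rgsAux zero    m = concatMap-pure (rgsAux m)
  extensions-rgsAux (suc L) m = begin
    concatMap (extensions (suc L)) (rgsAux m)
      ≡⟨ concatMap-concatMap (extensions L) extendRGS (rgsAux m) ⟨
    concatMap (extensions L) (rgsAux (suc m))
      ≡⟨ extensions-rgsAux L (suc m) ⟩
    rgsAux (L + suc m)
      ≡⟨ cong rgsAux (+-suc L m) ⟩
    rgsAux (suc L + m) ∎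

  -- A block is recorded by its label and the position of its last element.
  Block : Set
  Block = ℕ × ℕ

  entry : List ℕ → Block → Entry
  entry s (_ , pos) = (arcsOver pos (arcs s) , arcsBeyond pos (arcs s))

  IsLast : List ℕ → Block → Set
  IsLast s (c , pos) = LastOccurrence s c pos

  Ordered : List Block → Set
  Ordered = AllPairs (λ x y → proj₂ x < proj₂ y)

  record Blocks (s : List ℕ) (k : ℕ) (blocks : List Block) : Set where
    field
      labels<     : ∀ i → i < length s → at s i < k
      labels↭     : map proj₁ blocks ↭ upTo k
      lastOfBlock : All (IsLast s) blocks
      ordered     : Ordered blocks
  open Blocks

  ordered-split : ∀ pre {x post} → Ordered (pre ++ x ∷ post) →
    All (λ y → proj₂ y < proj₂ x) pre × All (λ y → proj₂ x < proj₂ y) post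
  ordered-split []        (x<post ∷ _) = [] , x<post
  ordered-split (y ∷ pre) (y<rest ∷ rest) with ordered-split pre rest | ++⁻ pre y<rest
  ... | before , after | _ , y<x ∷ _ = (y<x ∷ before) , after

  ordered-remove : ∀ pre {x post} → Ordered (pre ++ x ∷ post) → Ordered (pre ++ post)
  ordered-remove []        (_ ∷ rest)      = rest
  ordered-remove (y ∷ pre) (y<rest ∷ rest) with ++⁻ pre y<rest
  ... | y<pre , _ ∷ y<post = ++⁺ y<pre y<post ∷ ordered-remove pre rest

  ordered-∷ʳ : ∀ {xs z} → Ordered xs → All (λ y → proj₂ y < proj₂ z) xs → Ordered (xs ∷ʳ z)
  ordered-∷ʳ xs-ord xs<z = AllPairs.++⁺ xs-ord ([] ∷ []) (All.map (_∷ []) xs<z)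

  isLast-snoc-other : ∀ s c e → IsLast s e → c ≢ proj₁ e → IsLast (s ++ c ∷ []) e
  isLast-snoc-other s c (d , pos) last c≢d = record
    { pos<length = subst (pos <_) (sym (length-snoc s c)) (m<n⇒m<1+n (pos<length last))
    ; at-pos     = trans (at-++ˡ s (c ∷ []) pos (pos<length last)) (at-pos last)
    ; later≢     = later
    }
    where
    later : ∀ t → pos < t → t < length (s ++ c ∷ []) → at (s ++ c ∷ []) t ≢ d
    later t pos<t t<len with m≤n⇒m<n∨m≡n (s≤s⁻¹ (subst (t <_) (length-snoc s c) t<len))
    ... | inj₁ t<m  rewrite at-++ˡ s (c ∷ []) t t<m = later≢ last t pos<t t<m
    ... | inj₂ refl rewrite at-last s c = c≢d

  isLast-snoc-new : ∀ s c → IsLast (s ++ c ∷ []) (c , length s)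
  isLast-snoc-new s c = record
    { pos<length = subst (length s <_) (sym (length-snoc s c)) ≤-refl
    ; at-pos     = at-last s c
    ; later≢     = λ t m<t t<len → contradiction (subst (t <_) (length-snoc s c) t<len) (≤⇒≯ m<t)
    }

  labels<-snoc : ∀ s c k → (∀ i → i < length s → at s i < k) → c < k →
    ∀ i → i < length (s ++ c ∷ []) → at (s ++ c ∷ []) i < k
  labels<-snoc s c k s<k c<k i i<len with m≤n⇒m<n∨m≡n (s≤s⁻¹ (subst (i <_) (length-snoc s c) i<len))
  ... | inj₁ i<m  rewrite at-++ˡ s (c ∷ []) i i<m = s<k i i<m
  ... | inj₂ refl rewrite at-last s c = c<k

  entry-last : ∀ s c d → entry (s ++ c ∷ []) (d , length s) ≡ (0 , 0)
  entry-last s c d = cong₂ _,_ (arcsOver-top (s ++ c ∷ []) (length s) (length-snoc s c))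
                               (arcsBeyond-top (s ++ c ∷ []) (length s) (length-snoc s c))

  fresh-blocks : ∀ {s k blocks} → Blocks s k blocks → Blocks (s ++ k ∷ []) (suc k) (blocks ∷ʳ (k , length s))
  fresh-blocks {s} {k} {blocks} B = record
    { labels<     = labels<-snoc s k (suc k) (λ i i<m → m<n⇒m<1+n (labels< B i i<m)) ≤-refl
    ; labels↭     = ↭-trans (↭-reflexive (map-++ proj₁ blocks ((k , length s) ∷ [])))
                   (↭-trans (↭.++⁺ʳ (k ∷ []) (labels↭ B)) (↭-reflexive (upTo-∷ʳ k)))
    ; lastOfBlock = ++⁺ (All.map (λ {e} last → isLast-snoc-other s k e last (k≢label last)) (lastOfBlock B))
                        (isLast-snoc-new s k ∷ [])
    ; ordered     = ordered-∷ʳ (ordered B) (All.map pos<length (lastOfBlock B))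
    }
    where
    k≢label : ∀ {e} → IsLast s e → k ≢ proj₁ e
    k≢label last k≡d = <-irrefl (trans (at-pos last) (sym k≡d)) (labels< B _ (pos<length last))

  fresh-entries : ∀ {s k blocks} → Blocks s k blocks →
    map (entry (s ++ k ∷ [])) (blocks ∷ʳ (k , length s)) ≡ map (entry s) blocks ∷ʳ (0 , 0)
  fresh-entries {s} {k} {blocks} B = trans (map-++ (entry (s ++ k ∷ [])) blocks ((k , length s) ∷ []))
    (cong₂ (λ u v → u ++ v ∷ [])
      (map-cong (λ e → cong₂ _,_ (arcsOver-snoc (proj₂ e)) (arcsBeyond-snoc (proj₂ e))) blocks)
      (entry-last s k k))
    where open FreshBlock s k (λ i i<m k≡at → <-irrefl k≡at (labels< B i i<m))

  join-blocks : ∀ {s k} pre c pos post → Blocks s k (pre ++ (c , pos) ∷ post) →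
    Blocks (s ++ c ∷ []) k ((pre ++ post) ∷ʳ (c , length s))
  join-blocks {s} {k} pre c pos post B = record
    { labels<     = labels<-snoc s c k (labels< B) (subst (_< k) (at-pos last) (labels< B pos (pos<length last)))
    ; labels↭     = ↭-trans (↭-reflexive (trans (map-++ proj₁ (pre ++ post) ((c , length s) ∷ []))
                             (trans (cong (_++ c ∷ []) (map-++ proj₁ pre post)) (++-assoc (map proj₁ pre) (map proj₁ post) (c ∷ [])))))
                   (↭-trans (↭.++⁺ˡ (map proj₁ pre) (↭.++-comm (map proj₁ post) (c ∷ [])))
                   (↭-trans (↭-reflexive (sym (map-++ proj₁ pre ((c , pos) ∷ post)))) (labels↭ B)))
    ; lastOfBlock = ++⁺ (++⁺ (All.zipWith (λ (e<x , lastₑ) → isLast-snoc-other s c _ lastₑ (earlier≢ e<x lastₑ)) (pre<x , lastPre))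
                             (All.zipWith (λ (x<e , lastₑ) → isLast-snoc-other s c _ lastₑ (later≢′ x<e lastₑ)) (x<post , lastPost)))
                        (isLast-snoc-new s c ∷ [])
    ; ordered     = ordered-∷ʳ (ordered-remove pre (ordered B)) (All.map pos<length (++⁺ lastPre lastPost))
    }
    where
    split = ++⁻ pre (lastOfBlock B)
    lastPre = proj₁ split
    last = All.head (proj₂ split)
    lastPost = All.tail (proj₂ split)
    pre<x = proj₁ (ordered-split pre (ordered B))
    x<post = proj₂ (ordered-split pre (ordered B))
    earlier≢ : ∀ {e} → proj₂ e < pos → IsLast s e → c ≢ proj₁ e
    earlier≢ e<x lastₑ c≡d = later≢ lastₑ pos e<x (pos<length last) (trans (at-pos last) c≡d)
    later≢′ : ∀ {e} → pos < proj₂ e → IsLast s e → c ≢ proj₁ e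
    later≢′ x<e lastₑ c≡d = later≢ last _ x<e (pos<length lastₑ) (trans (at-pos lastₑ) (sym c≡d))

  join-entries : ∀ {s k} pre c pos post → Blocks s k (pre ++ (c , pos) ∷ post) →
    map (entry (s ++ c ∷ [])) ((pre ++ post) ∷ʳ (c , length s))
      ≡ joinState (map (entry s) pre) (map (entry s) post)
  join-entries {s} pre c pos post B = trans (map-++ (entry (s ++ c ∷ [])) (pre ++ post) ((c , length s) ∷ []))
    (cong₂ (λ u v → u ++ v ∷ [])
      (trans (map-++ (entry (s ++ c ∷ [])) pre post) (cong₂ _++_
        (trans (map-cong-local (All.map (λ e<x → cong₂ _,_ (arcsOver-earlier _ e<x) (arcsBeyond-earlier _ e<x)) pre<x)) (map-∘ pre))
        (trans (map-cong-local (All.zipWith (λ (x<e , lastₑ) → cong₂ _,_ (arcsOver-later _ x<e (pos<length lastₑ)) (arcsBeyond-later _ x<e))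
                                            (x<post , lastPost)))
               (map-∘ post))))
      (entry-last s c c))
    where
    split = ++⁻ pre (lastOfBlock B)
    lastPost = All.tail (proj₂ split)
    pre<x = proj₁ (ordered-split pre (ordered B))
    x<post = proj₂ (ordered-split pre (ordered B))
    open JoinBlock s c pos (All.head (proj₂ split))

  weight-+ : ∀ a b α β → q ^ (a + α) * p ^ (b + β) ≡ q ^ a * p ^ b * (q ^ α * p ^ β)
  weight-+ a b α β rewrite ^-distribˡ-+-* q a α | ^-distribˡ-+-* p b β = lemma (q ^ a) (q ^ α) (p ^ b) (p ^ β)
    where lemma : ∀ x y u v → x * y * (u * v) ≡ x * u * (y * v)
          lemma = solve-∀

  WeightFormula : ℕ → Set
  WeightFormula L = ∀ s k blocks → Blocks s k blocks → extensionsWeight L (s , k) ≡ W s * completionWeight L (map (entry s) blocks)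

  module Step (L : ℕ) (IH : WeightFormula L) where

    fresh : ∀ s k blocks → Blocks s k blocks →
      extensionsWeight L (s ++ k ∷ [] , suc k) ≡ W s * completionWeight L (map (entry s) blocks ∷ʳ (0 , 0))
    fresh s k blocks B = begin
      extensionsWeight L (s ++ k ∷ [] , suc k)
        ≡⟨ IH (s ++ k ∷ []) (suc k) (blocks ∷ʳ (k , length s)) (fresh-blocks B) ⟩
      W (s ++ k ∷ []) * completionWeight L (map (entry (s ++ k ∷ [])) (blocks ∷ʳ (k , length s)))
        ≡⟨ cong₂ (λ a b → a * completionWeight L b) (cong₂ (λ u v → q ^ u * p ^ v) cr-snoc ne-snoc) (fresh-entries B) ⟩
      W s * completionWeight L (map (entry s) blocks ∷ʳ (0 , 0)) ∎
      where open FreshBlock s k (λ i i<m k≡at → <-irrefl k≡at (labels< B i i<m))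

    join : ∀ s k pre c pos post → Blocks s k (pre ++ (c , pos) ∷ post) →
      extensionsWeight L (s ++ c ∷ [] , k)
        ≡ W s * (w (entry s (c , pos)) * completionWeight L (joinState (map (entry s) pre) (map (entry s) post)))
    join s k pre c pos post B = begin
      extensionsWeight L (s ++ c ∷ [] , k)
        ≡⟨ IH (s ++ c ∷ []) k ((pre ++ post) ∷ʳ (c , length s)) (join-blocks pre c pos post B) ⟩
      W (s ++ c ∷ []) * completionWeight L (map (entry (s ++ c ∷ [])) ((pre ++ post) ∷ʳ (c , length s)))
        ≡⟨ cong₂ (λ a b → a * completionWeight L b)
                 (trans (cong₂ (λ u v → q ^ u * p ^ v) cr-snoc ne-snoc) (weight-+ (cr s) (ne s) _ _))
                 (join-entries pre c pos post B) ⟩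
      W s * w (entry s (c , pos)) * completionWeight L (joinState (map (entry s) pre) (map (entry s) post))
        ≡⟨ *-assoc (W s) _ _ ⟩
      W s * (w (entry s (c , pos)) * completionWeight L (joinState (map (entry s) pre) (map (entry s) post))) ∎
      where open JoinBlock s c pos (All.head (proj₂ (++⁻ pre (lastOfBlock B))))

    joins : ∀ s k post pre → Blocks s k (pre ++ post) →
      sum (map (λ x → extensionsWeight L (s ++ proj₁ x ∷ [] , k)) post)
        ≡ W s * joinWeight (completionWeight L) (map (entry s) pre) (map (entry s) post)
    joins s k []               pre B = sym (*-zeroʳ (W s))
    joins s k ((c , pos) ∷ post) pre B = begin
      extensionsWeight L (s ++ c ∷ [] , k) + sum (map (λ x → extensionsWeight L (s ++ proj₁ x ∷ [] , k)) post)
        ≡⟨ cong₂ _+_ (join s k pre c pos post B)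
             (trans (joins s k post (pre ∷ʳ (c , pos)) (subst (Blocks s k) (sym (++-assoc pre ((c , pos) ∷ []) post)) B))
                    (cong (λ z → W s * joinWeight (completionWeight L) z (map (entry s) post)) (map-++ (entry s) pre ((c , pos) ∷ [])))) ⟩
      W s * (w (entry s (c , pos)) * completionWeight L (joinState (map (entry s) pre) (map (entry s) post)))
        + W s * joinWeight (completionWeight L) (map (entry s) pre ∷ʳ entry s (c , pos)) (map (entry s) post)
        ≡⟨ *-distribˡ-+ (W s) _ _ ⟨
      W s * joinWeight (completionWeight L) (map (entry s) pre) (map (entry s) ((c , pos) ∷ post)) ∎

  extensionsWeight≡ : ∀ L → WeightFormula L
  extensionsWeight≡ zero    s k blocks B = trans (+-identityʳ (W s)) (sym (*-identityʳ (W s)))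
  extensionsWeight≡ (suc L) s k blocks B = begin
    sum (map (W ∘ proj₁) (concatMap (extensions L) (extendRGS (s , k))))
      ≡⟨ sum-map-concatMap (W ∘ proj₁) (extensions L) (extendRGS (s , k)) ⟩
    sum (map (extensionsWeight L) (extendRGS (s , k)))
      ≡⟨ cong sum (map-∘ (upTo (suc k))) ⟨
    sum (map next (upTo (suc k)))
      ≡⟨ cong (sum ∘ map next) (upTo-∷ʳ k) ⟨
    sum (map next (upTo k ∷ʳ k))
      ≡⟨ sum-map-∷ʳ next (upTo k) k ⟩
    sum (map next (upTo k)) + next k
      ≡⟨ cong₂ _+_ (cong sum (map-upTo-cong k (λ c c<k → cong (λ b → extensionsWeight L (s ++ c ∷ [] , (if b then suc k else k))) (≡ᵇ-false (<⇒≢ c<k)))))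
                   (cong (λ b → extensionsWeight L (s ++ k ∷ [] , (if b then suc k else k))) (≡ᵇ-refl k)) ⟩
    sum (map old (upTo k)) + extensionsWeight L (s ++ k ∷ [] , suc k)
      ≡⟨ cong₂ _+_ (trans (sum-map-↭ old (↭-sym (labels↭ B))) (cong sum (sym (map-∘ blocks)))) (S.fresh s k blocks B) ⟩
    sum (map (old ∘ proj₁) blocks) + W s * completionWeight L (map (entry s) blocks ∷ʳ (0 , 0))
      ≡⟨ cong (_+ W s * completionWeight L (map (entry s) blocks ∷ʳ (0 , 0))) (S.joins s k blocks [] B) ⟩
    W s * joinWeight (completionWeight L) [] (map (entry s) blocks) + W s * completionWeight L (map (entry s) blocks ∷ʳ (0 , 0))
      ≡⟨ +-comm (W s * joinWeight (completionWeight L) [] (map (entry s) blocks)) _ ⟩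
    W s * completionWeight L (map (entry s) blocks ∷ʳ (0 , 0)) + W s * joinWeight (completionWeight L) [] (map (entry s) blocks)
      ≡⟨ *-distribˡ-+ (W s) _ _ ⟨
    W s * completionWeight (suc L) (map (entry s) blocks) ∎
    where
    module S = Step L (extensionsWeight≡ L)
    next : ℕ → ℕ
    next c = extensionsWeight L (s ++ c ∷ [] , (if c ≡ᵇ k then suc k else k))
    old : ℕ → ℕ
    old c = extensionsWeight L (s ++ c ∷ [] , k)

  no-blocks : Blocks [] 0 []
  no-blocks = record { labels< = λ _ () ; labels↭ = ↭-refl ; lastOfBlock = [] ; ordered = [] }

  sum-weights≡completionWeight : ∀ N → sum (map (W ∘ proj₁) (rgsAux N)) ≡ completionWeight N []
  sum-weights≡completionWeight N = begin
    sum (map (W ∘ proj₁) (rgsAux N))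
      ≡⟨ cong (sum ∘ map (W ∘ proj₁)) (trans (extensions-rgsAux N 0) (cong rgsAux (+-identityʳ N))) ⟨
    sum (map (W ∘ proj₁) (concatMap (extensions N) (rgsAux 0)))
      ≡⟨ cong (sum ∘ map (W ∘ proj₁)) (++-identityʳ (extensions N ([] , 0))) ⟩
    extensionsWeight N ([] , 0)
      ≡⟨ extensionsWeight≡ N [] 0 [] no-blocks ⟩
    1 * completionWeight N []
      ≡⟨ *-identityˡ _ ⟩
    completionWeight N [] ∎


module OneBlock (q p : ℕ) where

  open import Data.Nat
  open import Data.Nat.Properties
  open import Data.Bool using (Bool; true; false; _∧_; if_then_else_)
  open import Data.Product using (_×_; _,_; proj₁; ∃)
  open import Data.List using (List; []; _∷_; _++_; map; concatMap; upTo; length; replicate; drop)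
  open import Data.List.Properties using (++-identityʳ; ++-assoc; map-∘; map-cong; map-cong-local; concatMap-map; map-concatMap; concatMap-cong)
  open import Data.List.Relation.Unary.All as All using (All; []; _∷_)
  open import Data.List.Relation.Unary.All.Properties using (concat⁺; map⁺; all-upTo)
  open import Data.Nat.ListAction using (sum)
  open import Function using (_∘_)
  open import Relation.Binary.PropositionalEquality
  open import Relation.Nullary using (yes; no)
  open ≡-Reasoning
  open FiniteSums
  open Arcs
  open Insertion q p using (W; extendRGS; extensions; extensions-rgsAux)

  prefixWith : List ℕ → List ℕ × ℕ → List ℕ × ℕ
  prefixWith u (t , k) = (u ++ t , k)

  extensions-prefix : ∀ j u k → extensions j (u , k) ≡ map (prefixWith u) (extensions j ([] , k))
  extensions-prefix zero    u k = cong (λ v → (v , k) ∷ []) (sym (++-identityʳ u))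
  extensions-prefix (suc j) u k = begin
    concatMap (extensions j) (map (λ c → (u ++ c ∷ [] , next c)) (upTo (suc k)))
      ≡⟨ concatMap-map (extensions j) _ (upTo (suc k)) ⟩
    concatMap (λ c → extensions j (u ++ c ∷ [] , next c)) (upTo (suc k))
      ≡⟨ concatMap-cong step (upTo (suc k)) ⟩
    concatMap (λ c → map (prefixWith u) (extensions j (c ∷ [] , next c))) (upTo (suc k))
      ≡⟨ map-concatMap (prefixWith u) _ (upTo (suc k)) ⟨
    map (prefixWith u) (concatMap (λ c → extensions j (c ∷ [] , next c)) (upTo (suc k)))
      ≡⟨ cong (map (prefixWith u)) (concatMap-map (extensions j) _ (upTo (suc k))) ⟨
    map (prefixWith u) (concatMap (extensions j) (extendRGS ([] , k))) ∎
    where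
    next : ℕ → ℕ
    next c = if c ≡ᵇ k then suc k else k
    step : ∀ c → extensions j (u ++ c ∷ [] , next c) ≡ map (prefixWith u) (extensions j (c ∷ [] , next c))
    step c = begin
      extensions j (u ++ c ∷ [] , next c)
        ≡⟨ extensions-prefix j (u ++ c ∷ []) (next c) ⟩
      map (prefixWith (u ++ c ∷ [])) (extensions j ([] , next c))
        ≡⟨ map-cong (λ (t , k′) → cong (_, k′) (++-assoc u (c ∷ []) t)) _ ⟩
      map (prefixWith u ∘ prefixWith (c ∷ [])) (extensions j ([] , next c))
        ≡⟨ map-∘ (extensions j ([] , next c)) ⟩
      map (prefixWith u) (map (prefixWith (c ∷ [])) (extensions j ([] , next c)))
        ≡⟨ cong (map (prefixWith u)) (extensions-prefix j (c ∷ []) (next c)) ⟨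
      map (prefixWith u) (extensions j (c ∷ [] , next c)) ∎

  extensions-length : ∀ j k → All (λ y → length (proj₁ y) ≡ j) (extensions j ([] , k))
  extensions-length zero    k = refl ∷ []
  extensions-length (suc j) k = concat⁺ (map⁺ (map⁺ (All.map (λ {c} _ →
      subst (All (λ y → length (proj₁ y) ≡ suc j)) (sym (extensions-prefix j (c ∷ []) _))
            (map⁺ (All.map (cong suc) (extensions-length j _))))
    (all-upTo (suc k)))))

  rgsAux-length : ∀ l → All (λ x → length (proj₁ x) ≡ l) (rgsAux l)
  rgsAux-length l = subst (All (λ x → length (proj₁ x) ≡ l))
    (trans (sym (++-identityʳ (extensions l ([] , 0)))) (trans (extensions-rgsAux l 0) (cong rgsAux (+-identityʳ l))))
    (extensions-length l 0)

  allEqual : ℕ → List ℕ → Bool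
  allEqual c t = all (λ x → x ≡ᵇ c) t

  allEqual-sound : ∀ c t → allEqual c t ≡ true → ∀ i → i < length t → at t i ≡ c
  allEqual-sound c (x ∷ t) eq zero    _     = ≡ᵇ-sound (∧-true₁ eq)
  allEqual-sound c (x ∷ t) eq (suc i) i<len = allEqual-sound c t (∧-true₂ (x ≡ᵇ c) eq) i (s≤s⁻¹ i<len)

  allEqual-witness : ∀ c t → allEqual c t ≡ false → ∃ λ i → i < length t × at t i ≢ c
  allEqual-witness c (x ∷ t) eq with x ≟ c
  ... | no  x≢c = 0 , z<s , x≢c
  ... | yes refl rewrite ≡ᵇ-refl x with allEqual-witness x t eq
  ...   | i , i<len , at≢ = suc i , s≤s i<len , at≢

  at-replicate-0 : ∀ n i → at (replicate n 0) i ≡ 0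
  at-replicate-0 zero    i       = refl
  at-replicate-0 (suc n) zero    = refl
  at-replicate-0 (suc n) (suc i) = at-replicate-0 n i

  drop-length-++ : ∀ (s t : List ℕ) → drop (length s) (s ++ t) ≡ t
  drop-length-++ []      t = refl
  drop-length-++ (x ∷ s) t = drop-length-++ s t

  sameBlocks : ℕ → List ℕ → List ℕ → Bool
  sameBlocks n π b = all (λ i → all (λ j → (at b i ≡ᵇ at b j) == (at π i ≡ᵇ at π j)) (upTo n)) (upTo n)

  ==-true : ∀ b → (b == true) ≡ b
  ==-true true  = refl
  ==-true false = refl

  sameBlocks-oneBlock : ∀ c t → sameBlocks (suc (length t)) (replicate (suc (length t)) 0) (c ∷ t) ≡ allEqual c t
  sameBlocks-oneBlock c t = trans
    (all-upTo-cong n _ _ (λ i _ → all-upTo-cong n _ _ (λ i′ _ →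
      trans (cong (λ b → (at (c ∷ t) i ≡ᵇ at (c ∷ t) i′) == b) (cong₂ _≡ᵇ_ (at-replicate-0 n i) (at-replicate-0 n i′))) (==-true _))))
    (decide (allEqual c t) refl)
    where
    n = suc (length t)
    decide : ∀ b → allEqual c t ≡ b →
      all (λ i → all (λ i′ → at (c ∷ t) i ≡ᵇ at (c ∷ t) i′) (upTo n)) (upTo n) ≡ b
    decide true  all≡ = all-upTo-true n _ (λ i i<n → all-upTo-true n _ (λ i′ i′<n →
        trans (cong₂ _≡ᵇ_ (at-c i i<n) (at-c i′ i′<n)) (≡ᵇ-refl c)))
      where
      at-c : ∀ i → i < n → at (c ∷ t) i ≡ c
      at-c zero    _     = refl
      at-c (suc i) i<n = allEqual-sound c t all≡ i (s≤s⁻¹ i<n)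
    decide false all≡ with allEqual-witness c t all≡
    ... | i , i<len , at≢c = all-upTo-false n _ (suc i) (s≤s i<len) (all-upTo-false n _ 0 z<s (≡ᵇ-false at≢c))

  inT-oneBlock : ∀ j l s c t → length s ≡ l → length t ≡ j →
    inT (suc j) (replicate (suc j) 0) l ((s ++ c ∷ []) ++ t) ≡ allEqual c t
  inT-oneBlock _ _ s c t refl refl = begin
    sameBlocks n π (drop (length s) ((s ++ c ∷ []) ++ t))
      ≡⟨ cong (sameBlocks n π ∘ drop (length s)) (++-assoc s (c ∷ []) t) ⟩
    sameBlocks n π (drop (length s) (s ++ c ∷ t))
      ≡⟨ cong (sameBlocks n π) (drop-length-++ s (c ∷ t)) ⟩
    sameBlocks n π (c ∷ t)
      ≡⟨ sameBlocks-oneBlock c t ⟩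
    allEqual c t ∎
    where
    n = suc (length t)
    π = replicate n 0

  W-repeat-last : ∀ u c → W ((u ++ c ∷ []) ++ c ∷ []) ≡ W (u ++ c ∷ [])
  W-repeat-last u c = cong₂ (λ a b → q ^ a * p ^ b)
    (trans cr-snoc (trans (cong (cr u′ +_) (arcsOver-top u′ (length u) (length-snoc u c))) (+-identityʳ _)))
    (trans ne-snoc (trans (cong (ne u′ +_) (arcsBeyond-top u′ (length u) (length-snoc u c))) (+-identityʳ _)))
    where
    u′ = u ++ c ∷ []
    open JoinBlock u′ c (length u) (Insertion.isLast-snoc-new q p u c)

  W-repeat : ∀ u c r → W ((u ++ c ∷ []) ++ replicate r c) ≡ W (u ++ c ∷ [])
  W-repeat u c zero    = cong W (++-identityʳ (u ++ c ∷ []))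
  W-repeat u c (suc r) = begin
    W ((u ++ c ∷ []) ++ c ∷ replicate r c)
      ≡⟨ cong W (++-assoc (u ++ c ∷ []) (c ∷ []) (replicate r c)) ⟨
    W (((u ++ c ∷ []) ++ c ∷ []) ++ replicate r c)
      ≡⟨ W-repeat (u ++ c ∷ []) c r ⟩
    W ((u ++ c ∷ []) ++ c ∷ [])
      ≡⟨ W-repeat-last u c ⟩
    W (u ++ c ∷ []) ∎

  constantTail : ℕ → List ℕ → List ℕ × ℕ → ℕ
  constantTail c u (t , _) = if allEqual c t then W (u ++ t) else 0

  sum-constantTail : ∀ j k u c → c < k → (∀ r → W (u ++ replicate r c) ≡ W u) →
    sum (map (constantTail c u) (extensions j ([] , k))) ≡ W u
  sum-constantTail zero    k u c c<k repeat = trans (+-identityʳ _) (cong W (++-identityʳ u))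
  sum-constantTail (suc j) k u c c<k repeat = begin
    sum (map (constantTail c u) (concatMap (extensions j) (extendRGS ([] , k))))
      ≡⟨ sum-map-concatMap (constantTail c u) (extensions j) (extendRGS ([] , k)) ⟩
    sum (map (λ x → sum (map (constantTail c u) (extensions j x))) (extendRGS ([] , k)))
      ≡⟨ cong sum (map-∘ (upTo (suc k))) ⟨
    sum (map first (upTo (suc k)))
      ≡⟨ sum-map-upTo-single (suc k) first c (m<n⇒m<1+n c<k) first≢c ⟩
    first c
      ≡⟨ first-c ⟩
    W u ∎
    where
    next : ℕ → ℕ
    next d = if d ≡ᵇ k then suc k else k
    first : ℕ → ℕ
    first d = sum (map (constantTail c u) (extensions j (d ∷ [] , next d)))
    first-prefix : ∀ d → first d ≡ sum (map (constantTail c u ∘ prefixWith (d ∷ [])) (extensions j ([] , next d)))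
    first-prefix d = trans (cong (sum ∘ map (constantTail c u)) (extensions-prefix j (d ∷ []) (next d)))
                           (cong sum (sym (map-∘ (extensions j ([] , next d)))))
    first≢c : ∀ d → d < suc k → d ≢ c → first d ≡ 0
    first≢c d _ d≢c = trans (first-prefix d) (sum-map-zero′ (λ (t , _) →
      cong (λ b → if b ∧ allEqual c t then W (u ++ d ∷ t) else 0) (≡ᵇ-false d≢c)) (extensions j ([] , next d)))
    first-c : first c ≡ W u
    first-c = begin
      first c                                                              ≡⟨ first-prefix c ⟩
      sum (map (constantTail c u ∘ prefixWith (c ∷ [])) (extensions j ([] , next c)))
        ≡⟨ cong sum (map-cong (λ (t , _) → trans (cong (λ b → if b ∧ allEqual c t then W (u ++ c ∷ t) else 0) (≡ᵇ-refl c))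
                                               (cong (λ v → if allEqual c t then W v else 0) (sym (++-assoc u (c ∷ []) t)))) (extensions j ([] , next c))) ⟩
      sum (map (constantTail c (u ++ c ∷ [])) (extensions j ([] , next c)))
        ≡⟨ cong (λ b → sum (map (constantTail c (u ++ c ∷ [])) (extensions j ([] , (if b then suc k else k))))) (≡ᵇ-false (<⇒≢ c<k)) ⟩
      sum (map (constantTail c (u ++ c ∷ [])) (extensions j ([] , k)))
        ≡⟨ sum-constantTail j k (u ++ c ∷ []) c c<k (λ r →
             trans (cong W (++-assoc u (c ∷ []) (replicate r c))) (trans (repeat (suc r)) (sym (repeat 1)))) ⟩
      W (u ++ c ∷ [])                                                      ≡⟨ repeat 1 ⟩
      W u                                                                  ∎

  weightIfIn : ℕ → ℕ → List ℕ → ℕ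
  weightIfIn j l a = if inT (suc j) (replicate (suc j) 0) l a then W a else 0

  -- Past position l + 1 the partition must continue with copies of its last label.
  sum-extensions-oneBlock : ∀ j l s k → length s ≡ l →
    sum (map (weightIfIn j l ∘ proj₁) (extensions (suc j) (s , k))) ≡ sum (map (W ∘ proj₁) (extendRGS (s , k)))
  sum-extensions-oneBlock j l s k len = begin
    sum (map (weightIfIn j l ∘ proj₁) (concatMap (extensions j) (extendRGS (s , k))))
      ≡⟨ sum-map-concatMap (weightIfIn j l ∘ proj₁) (extensions j) (extendRGS (s , k)) ⟩
    sum (map (λ y → sum (map (weightIfIn j l ∘ proj₁) (extensions j y))) (extendRGS (s , k)))
      ≡⟨ cong sum (map-∘ (upTo (suc k))) ⟨
    sum (map (λ c → sum (map (weightIfIn j l ∘ proj₁) (extensions j (s ++ c ∷ [] , next c)))) (upTo (suc k)))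
      ≡⟨ cong sum (map-upTo-cong (suc k) afterLabel) ⟩
    sum (map (λ c → W (s ++ c ∷ [])) (upTo (suc k)))
      ≡⟨ cong sum (map-∘ (upTo (suc k))) ⟩
    sum (map (W ∘ proj₁) (extendRGS (s , k))) ∎
    where
    next : ℕ → ℕ
    next c = if c ≡ᵇ k then suc k else k
    c<next : ∀ c → c < suc k → c < next c
    c<next c c<1+k with c ≟ k
    ... | yes refl rewrite ≡ᵇ-refl c = c<1+k
    ... | no  c≢k  rewrite ≡ᵇ-false c≢k = ≤∧≢⇒< (s≤s⁻¹ c<1+k) c≢k
    afterLabel : ∀ c → c < suc k → sum (map (weightIfIn j l ∘ proj₁) (extensions j (s ++ c ∷ [] , next c))) ≡ W (s ++ c ∷ [])
    afterLabel c c<1+k = begin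
      sum (map (weightIfIn j l ∘ proj₁) (extensions j (s ++ c ∷ [] , next c)))
        ≡⟨ cong (sum ∘ map (weightIfIn j l ∘ proj₁)) (extensions-prefix j (s ++ c ∷ []) (next c)) ⟩
      sum (map (weightIfIn j l ∘ proj₁) (map (prefixWith (s ++ c ∷ [])) (extensions j ([] , next c))))
        ≡⟨ cong sum (map-∘ (extensions j ([] , next c))) ⟨
      sum (map (weightIfIn j l ∘ proj₁ ∘ prefixWith (s ++ c ∷ [])) (extensions j ([] , next c)))
        ≡⟨ cong sum (map-cong-local (All.map (λ {(t , _)} len-t → cong (λ b → if b then W ((s ++ c ∷ []) ++ t) else 0)
                                                                      (inT-oneBlock j l s c t len len-t))
                                             (extensions-length j (next c)))) ⟩
      sum (map (constantTail c (s ++ c ∷ [])) (extensions j ([] , next c)))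
        ≡⟨ sum-constantTail j (next c) (s ++ c ∷ []) c (c<next c c<1+k) (W-repeat s c) ⟩
      W (s ++ c ∷ []) ∎

  Scoeff-oneBlock : ∀ j l → Scoeff q p (suc j) (replicate (suc j) 0) l ≡ sum (map (W ∘ proj₁) (rgsAux (suc l)))
  Scoeff-oneBlock j l = begin
    sum (map (weightIfIn j l) (map proj₁ (rgsAux (suc j + l))))
      ≡⟨ cong sum (map-∘ (rgsAux (suc j + l))) ⟨
    sum (map (weightIfIn j l ∘ proj₁) (rgsAux (suc j + l)))
      ≡⟨ cong (sum ∘ map (weightIfIn j l ∘ proj₁)) (extensions-rgsAux (suc j) l) ⟨
    sum (map (weightIfIn j l ∘ proj₁) (concatMap (extensions (suc j)) (rgsAux l)))
      ≡⟨ sum-map-concatMap (weightIfIn j l ∘ proj₁) (extensions (suc j)) (rgsAux l) ⟩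
    sum (map (λ x → sum (map (weightIfIn j l ∘ proj₁) (extensions (suc j) x))) (rgsAux l))
      ≡⟨ cong sum (map-cong-local (All.map (λ {(s , k)} len → sum-extensions-oneBlock j l s k len) (rgsAux-length l))) ⟩
    sum (map (λ x → sum (map (W ∘ proj₁) (extendRGS x))) (rgsAux l))
      ≡⟨ sum-map-concatMap (W ∘ proj₁) extendRGS (rgsAux l) ⟨
    sum (map (W ∘ proj₁) (rgsAux (suc l))) ∎


open import Data.Nat using (_+_)
open import Data.Nat.Properties using (+-identityʳ)
open import Data.List using ([]; map)
open import Data.Nat.ListAction using (sum)
open import Data.Product using (proj₁)
open import Function using (_∘_)
open import Relation.Binary.PropositionalEquality using (module ≡-Reasoning)
open ≡-Reasoning

corollary5p3 : (q p n : ℕ) → 1 ≤ n → (l D : ℕ) → l < D →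
    Scoeff q p n (replicate n 0) l ≡ convergent q p D l
corollary5p3 q p (suc j) (s≤s z≤n) l D l<D = begin
  Scoeff q p (suc j) (replicate (suc j) 0) l ≡⟨ OneBlock.Scoeff-oneBlock q p j l ⟩
  sum (map (W ∘ proj₁) (rgsAux (suc l)))     ≡⟨ sum-weights≡completionWeight (suc l) ⟩
  completionWeight (suc l) []                ≡⟨ completionWeight≡subsetSum (suc l) [] ⟩
  charlier 0 (suc l)                         ≡⟨ charlier-suc l 0 ⟩
  motzkin 0 l + 0                            ≡⟨ +-identityʳ (motzkin 0 l) ⟩
  motzkin 0 l                                ≡⟨ convergent≡motzkin D l l<D ⟨
  convergent q p D l                         ∎
  where
  open Insertion q p using (W; sum-weights≡completionWeight)
  open BlockStates q p using (completionWeight; completionWeight≡subsetSum)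
  open CharlierPaths q p using (charlier; charlier-suc)
  open JFraction q p using (motzkin; convergent≡motzkin)
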